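{- For every sequent $\Gamma\Rightarrow\delta$ of first-order arithmetic: if $\mathrm{SHA}\vdash\Gamma\Rightarrow\delta$ then $\mathrm{HA}\vdash\Gamma\Rightarrow\delta$.
   Context: Language: terms from variables, $0,S,+,\cdot$; formulas from $s=t,\bot,\wedge,\vee,\to,\forall,\exists$. $\mathrm{HA}$-sequents $\Gamma\Rightarrow\delta$: finite set $\Gamma$, single formula $\delta$. $\mathrm{HA}$: sequent calculus (finite tree proofs) with the standard intuitionistic rules Ax ($\Gamma,\delta\Rightarrow\delta$), $\to$L/R, $\wedge$L/R, $\vee$L/R, $\forall$L/R, $\exists$L/R (usual eigenvariable conditions), $\bot$L, $=$L (from $\Gamma[x/y]\Rightarrow\delta[x/y]$ infer $\Gamma[s/x,t/y],s=t\Rightarrow\delta[s/x,t/y]$, $x,y\notin\mathrm{FV}(s,t)$), $=$R ($\Gamma\Rightarrow t=t$), weakening, cut, arithmetic axioms $\Rightarrow 0\neq St$, $Ss=St\Rightarrow s=t$, $\Rightarrow s+0=s$, $\Rightarrow s+St=S(s+t)$, $\Rightarrow s\cdot0=0$, $\Rightarrow s\cdot St=(s\cdot t)+s$, and induction axioms $\varphi(0),\forall x.\,\varphi(x)\to\varphi(Sx)\Rightarrow\varphi(s)$. $\mathrm{SHA}$ (stack-labelled Heyting arithmetic): a companion label is $x^\bullet\mapsto\Gamma\Rightarrow\delta$ with $\Gamma\Rightarrow\delta$ an $\mathrm{HA}$-sequent, $x\in\mathrm{FV}(\Gamma,\delta)$, $x^\bullet\in\{x^+,x^-\}$. A stack $\Lambda$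 is a finite list of labels ($\Lambda;\ell$ appends $\ell$ last; $\varepsilon$ is empty); $\textsc{Var}(\Lambda)$ is the set of variables of its labels; $\Lambda^{+x}$ replaces every $x^-$ in $\Lambda$ by $x^+$. $\mathrm{SHA}$-sequents are $\Lambda\mid\Gamma\Rightarrow\delta$, well-formed if every variable of $\textsc{Var}(\Lambda)$ is free in $\Gamma,\delta$. Rules: (i) every logical rule of $\mathrm{HA}$ above (including weakening, cut, $=$L, $=$R, $\bot$L) with the same stack in conclusion and premises, the eigenvariable of $\forall$R/$\exists$L also not occurring in $\Lambda$; (ii) Ax and the arithmetic axioms only with empty stack ($\varepsilon\mid\Gamma,\delta\Rightarrow\delta$, $\varepsilon\mid\Gamma\Rightarrow0\neq St$, $\varepsilon\mid\Gamma,Ss=St\Rightarrow s=t$, etc.); (iii) Comp (from $\Lambda;(x^-\mapsto\Gamma\Rightarrow\delta)\mid\Gamma\Rightarrow\delta$ infer $\Lambda\mid\Gamma\Rightarrow\delta$), Bud (axiom $\Lambda;(x^+\mapsto\Gamma\Rightarrow\delta)\mid\Gamma\Rightarrow\delta$), Pop (from $\Lambda\mid\Gamma\Rightarrow\delta$ infer $\Lambda;\Lambda'\mid\Gamma\Rightarrow\delta$), $\textsc{Case}_x$ (from $\Lambda\mid\Gamma[0/x]\Rightarrow\delta[0/x]$ and $\Lambda^{+x}\mid\Gamma[Sx/x]\Rightarrow\delta[Sx/x]$ infer $\Lambda\mid\Gamma\Rightarrow\delta$). Proofs are finite trees; every rule except Pop may only derive well-formed sequents. $\mathrm{SHA}\vdash\Gamma\Rightarrow\delta$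 means there is a proof of $\varepsilon\mid\Gamma\Rightarrow\delta$. -}

module Defs where

open import Data.Nat using (ℕ; zero; suc)
open import Data.Nat.Properties using (_≟_)
open import Data.Fin using (Fin; zero; suc)
open import Data.List using (List; []; _∷_; _++_; [_]; map; concatMap)
open import Data.List.Membership.Propositional using (_∈_; _∉_)
open import Data.List.Relation.Unary.All using (All)
open import Data.List.Relation.Binary.Subset.Propositional using (_⊆_)
open import Data.Bool using (if_then_else_)
open import Relation.Nullary using (does)
open import Relation.Binary.PropositionalEquality using (_≡_; _≢_)

-- Free variables are named by natural numbers (`var x`); bound variables
-- are well-scoped de Bruijn indices (`bvar i`, i : Fin n), so
-- `Term 0` / `Formula 0` are exactly the (locally closed) terms/formulas,
-- and substitution is automatically capture-free.

data Term (n : ℕ) : Set where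
  var  : ℕ → Term n
  bvar : Fin n → Term n
  `0   : Term n
  `S   : Term n → Term n
  _`+_ : Term n → Term n → Term n
  _`·_ : Term n → Term n → Term n

infix  6 _≐_
infixr 5 _∧'_ _∨'_
infixr 4 _⇒'_

data Formula (n : ℕ) : Set where
  _≐_  : Term n → Term n → Formula n
  ⊥'   : Formula n
  _∧'_ : Formula n → Formula n → Formula n
  _∨'_ : Formula n → Formula n → Formula n
  _⇒'_ : Formula n → Formula n → Formula n
  ∀'   : Formula (suc n) → Formula n
  ∃'   : Formula (suc n) → Formula n

_≠'_ : Term 0 → Term 0 → Formula 0
s ≠' t = (s ≐ t) ⇒' ⊥'

Ctx : Set
Ctx = List (Formula 0)

renT : ∀ {n m} → (Fin n → Fin m) → Term n → Term m
renT ρ (var x)   = var x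
renT ρ (bvar i)  = bvar (ρ i)
renT ρ `0        = `0
renT ρ (`S t)    = `S (renT ρ t)
renT ρ (s `+ t)  = renT ρ s `+ renT ρ t
renT ρ (s `· t)  = renT ρ s `· renT ρ t

bsubT : ∀ {n m} → (Fin n → Term m) → Term n → Term m
bsubT σ (var x)   = var x
bsubT σ (bvar i)  = σ i
bsubT σ `0        = `0
bsubT σ (`S t)    = `S (bsubT σ t)
bsubT σ (s `+ t)  = bsubT σ s `+ bsubT σ t
bsubT σ (s `· t)  = bsubT σ s `· bsubT σ t

liftσ : ∀ {n m} → (Fin n → Term m) → Fin (suc n) → Term (suc m)
liftσ σ zero    = bvar zero
liftσ σ (suc i) = renT suc (σ i)

bsubF : ∀ {n m} → (Fin n → Term m) → Formula n → Formula m
bsubF σ (s ≐ t)   = bsubT σ s ≐ bsubT σ t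
bsubF σ ⊥'        = ⊥'
bsubF σ (φ ∧' ψ)  = bsubF σ φ ∧' bsubF σ ψ
bsubF σ (φ ∨' ψ)  = bsubF σ φ ∨' bsubF σ ψ
bsubF σ (φ ⇒' ψ)  = bsubF σ φ ⇒' bsubF σ ψ
bsubF σ (∀' φ)    = ∀' (bsubF (liftσ σ) φ)
bsubF σ (∃' φ)    = ∃' (bsubF (liftσ σ) φ)

inst : Formula 1 → Term 0 → Formula 0
inst φ t = bsubF (λ _ → t) φ

instS : Formula 1 → Formula 1
instS φ = bsubF (λ _ → `S (bvar zero)) φ

embT : ∀ {n} → Term 0 → Term n
embT (var x)  = var x
embT (bvar ())
embT `0       = `0
embT (`S t)   = `S (embT t)
embT (s `+ t) = embT s `+ embT t
embT (s `· t) = embT s `· embT t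

FSub : Set
FSub = ℕ → Term 0

fsubT : ∀ {n} → FSub → Term n → Term n
fsubT σ (var x)   = embT (σ x)
fsubT σ (bvar i)  = bvar i
fsubT σ `0        = `0
fsubT σ (`S t)    = `S (fsubT σ t)
fsubT σ (s `+ t)  = fsubT σ s `+ fsubT σ t
fsubT σ (s `· t)  = fsubT σ s `· fsubT σ t

fsubF : ∀ {n} → FSub → Formula n → Formula n
fsubF σ (s ≐ t)   = fsubT σ s ≐ fsubT σ t
fsubF σ ⊥'        = ⊥'
fsubF σ (φ ∧' ψ)  = fsubF σ φ ∧' fsubF σ ψ
fsubF σ (φ ∨' ψ)  = fsubF σ φ ∨' fsubF σ ψ
fsubF σ (φ ⇒' ψ)  = fsubF σ φ ⇒' fsubF σ ψ
fsubF σ (∀' φ)    = ∀' (fsubF σ φ)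
fsubF σ (∃' φ)    = ∃' (fsubF σ φ)

fsubC : FSub → Ctx → Ctx
fsubC σ Γ = map (fsubF σ) Γ

update : FSub → ℕ → Term 0 → FSub
update σ x t y = if does (y ≟ x) then t else σ y

[_/_] : Term 0 → ℕ → FSub
[ t / x ] = update var x t

fvT : ∀ {n} → Term n → List ℕ
fvT (var x)   = x ∷ []
fvT (bvar i)  = []
fvT `0        = []
fvT (`S t)    = fvT t
fvT (s `+ t)  = fvT s ++ fvT t
fvT (s `· t)  = fvT s ++ fvT t

fvF : ∀ {n} → Formula n → List ℕ
fvF (s ≐ t)   = fvT s ++ fvT t
fvF ⊥'        = []
fvF (φ ∧' ψ)  = fvF φ ++ fvF ψ
fvF (φ ∨' ψ)  = fvF φ ++ fvF ψ
fvF (φ ⇒' ψ)  = fvF φ ++ fvF ψ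
fvF (∀' φ)    = fvF φ
fvF (∃' φ)    = fvF φ

fvC : Ctx → List ℕ
fvC Γ = concatMap fvF Γ

fvSeq : Ctx → Formula 0 → List ℕ
fvSeq Γ δ = fvC Γ ++ fvF δ

-- HA: intuitionistic sequent calculus for Heyting arithmetic.
-- Γ is a finite *set* of formulas; it is represented by a list together
-- with the rule `hSet` which identifies lists with the same elements.
-- "Γ, φ" is rendered as φ ∷ Γ.

infix 2 _⊢HA_

data _⊢HA_ : Ctx → Formula 0 → Set where
  hSet  : ∀ {Γ Γ' δ} → Γ ⊆ Γ' → Γ' ⊆ Γ → Γ ⊢HA δ → Γ' ⊢HA δ
  hAx   : ∀ {Γ δ} → δ ∷ Γ ⊢HA δ
  h→L   : ∀ {Γ φ ψ δ} → Γ ⊢HA φ → ψ ∷ Γ ⊢HA δ → (φ ⇒' ψ) ∷ Γ ⊢HA δ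
  h→R   : ∀ {Γ φ ψ} → φ ∷ Γ ⊢HA ψ → Γ ⊢HA φ ⇒' ψ
  h∧L   : ∀ {Γ φ ψ δ} → φ ∷ ψ ∷ Γ ⊢HA δ → (φ ∧' ψ) ∷ Γ ⊢HA δ
  h∧R   : ∀ {Γ φ ψ} → Γ ⊢HA φ → Γ ⊢HA ψ → Γ ⊢HA φ ∧' ψ
  h∨L   : ∀ {Γ φ ψ δ} → φ ∷ Γ ⊢HA δ → ψ ∷ Γ ⊢HA δ → (φ ∨' ψ) ∷ Γ ⊢HA δ
  h∨R₁  : ∀ {Γ φ ψ} → Γ ⊢HA φ → Γ ⊢HA φ ∨' ψ
  h∨R₂  : ∀ {Γ φ ψ} → Γ ⊢HA ψ → Γ ⊢HA φ ∨' ψ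
  h∀L   : ∀ {Γ φ δ} (t : Term 0) → inst φ t ∷ Γ ⊢HA δ → ∀' φ ∷ Γ ⊢HA δ
  h∀R   : ∀ {Γ φ} (y : ℕ) → y ∉ fvSeq Γ (∀' φ) →
          Γ ⊢HA inst φ (var y) → Γ ⊢HA ∀' φ
  h∃L   : ∀ {Γ φ δ} (y : ℕ) → y ∉ fvSeq (∃' φ ∷ Γ) δ →
          inst φ (var y) ∷ Γ ⊢HA δ → ∃' φ ∷ Γ ⊢HA δ
  h∃R   : ∀ {Γ φ} (t : Term 0) → Γ ⊢HA inst φ t → Γ ⊢HA ∃' φ
  h⊥L   : ∀ {Γ δ} → ⊥' ∷ Γ ⊢HA δ
  h=L   : ∀ {Γ δ} (x y : ℕ) (s t : Term 0) → x ≢ y →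
          x ∉ fvT s → x ∉ fvT t → y ∉ fvT s → y ∉ fvT t →
          fsubC [ var x / y ] Γ ⊢HA fsubF [ var x / y ] δ →
          (s ≐ t) ∷ fsubC (update [ s / x ] y t) Γ
            ⊢HA fsubF (update [ s / x ] y t) δ
  h=R   : ∀ {Γ} (t : Term 0) → Γ ⊢HA t ≐ t
  hWk   : ∀ {Γ φ δ} → Γ ⊢HA δ → φ ∷ Γ ⊢HA δ
  hCut  : ∀ {Γ φ δ} → Γ ⊢HA φ → φ ∷ Γ ⊢HA δ → Γ ⊢HA δ
  hA0S  : ∀ {Γ} (t : Term 0) → Γ ⊢HA `0 ≠' `S t
  hASS  : ∀ {Γ} (s t : Term 0) → (`S s ≐ `S t) ∷ Γ ⊢HA s ≐ t
  hA+0  : ∀ {Γ} (s : Term 0) → Γ ⊢HA (s `+ `0) ≐ s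
  hA+S  : ∀ {Γ} (s t : Term 0) → Γ ⊢HA (s `+ `S t) ≐ `S (s `+ t)
  hA·0  : ∀ {Γ} (s : Term 0) → Γ ⊢HA (s `· `0) ≐ `0
  hA·S  : ∀ {Γ} (s t : Term 0) → Γ ⊢HA (s `· `S t) ≐ ((s `· t) `+ s)
  hInd  : ∀ {Γ} (φ : Formula 1) (s : Term 0) →
          inst φ `0 ∷ ∀' (φ ⇒' instS φ) ∷ Γ ⊢HA inst φ s

HA⊢ : Ctx → Formula 0 → Set
HA⊢ Γ δ = Γ ⊢HA δ

data Pol : Set where
  plus minus : Pol

record Label : Set where
  constructor mkLabel
  field
    lvar  : ℕ
    lpol  : Pol
    lctx  : Ctx
    lgoal : Formula 0
    lfv   : lvar ∈ fvSeq lctx lgoal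

open Label public

Stack : Set
Stack = List Label

_︔_ : Stack → Label → Stack
Λ ︔ ℓ = Λ ++ [ ℓ ]

VarS : Stack → List ℕ
VarS Λ = map lvar Λ

plusAt : ℕ → Stack → Stack
plusAt x Λ = map (λ ℓ → if does (lvar ℓ ≟ x) then record ℓ { lpol = plus } else ℓ) Λ

WF : Stack → Ctx → Formula 0 → Set
WF Λ Γ δ = All (λ ℓ → lvar ℓ ∈ fvSeq Γ δ) Λ

infix 2 _∣_⊢SHA_

data _∣_⊢SHA_ : Stack → Ctx → Formula 0 → Set where
  sSet  : ∀ {Λ Γ Γ' δ} → WF Λ Γ' δ → Γ ⊆ Γ' → Γ' ⊆ Γ →
          Λ ∣ Γ ⊢SHA δ → Λ ∣ Γ' ⊢SHA δ
  s→L   : ∀ {Λ Γ φ ψ δ} → WF Λ ((φ ⇒' ψ) ∷ Γ) δ →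
          Λ ∣ Γ ⊢SHA φ → Λ ∣ ψ ∷ Γ ⊢SHA δ → Λ ∣ (φ ⇒' ψ) ∷ Γ ⊢SHA δ
  s→R   : ∀ {Λ Γ φ ψ} → WF Λ Γ (φ ⇒' ψ) →
          Λ ∣ φ ∷ Γ ⊢SHA ψ → Λ ∣ Γ ⊢SHA φ ⇒' ψ
  s∧L   : ∀ {Λ Γ φ ψ δ} → WF Λ ((φ ∧' ψ) ∷ Γ) δ →
          Λ ∣ φ ∷ ψ ∷ Γ ⊢SHA δ → Λ ∣ (φ ∧' ψ) ∷ Γ ⊢SHA δ
  s∧R   : ∀ {Λ Γ φ ψ} → WF Λ Γ (φ ∧' ψ) →
          Λ ∣ Γ ⊢SHA φ → Λ ∣ Γ ⊢SHA ψ → Λ ∣ Γ ⊢SHA φ ∧' ψ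
  s∨L   : ∀ {Λ Γ φ ψ δ} → WF Λ ((φ ∨' ψ) ∷ Γ) δ →
          Λ ∣ φ ∷ Γ ⊢SHA δ → Λ ∣ ψ ∷ Γ ⊢SHA δ → Λ ∣ (φ ∨' ψ) ∷ Γ ⊢SHA δ
  s∨R₁  : ∀ {Λ Γ φ ψ} → WF Λ Γ (φ ∨' ψ) →
          Λ ∣ Γ ⊢SHA φ → Λ ∣ Γ ⊢SHA φ ∨' ψ
  s∨R₂  : ∀ {Λ Γ φ ψ} → WF Λ Γ (φ ∨' ψ) →
          Λ ∣ Γ ⊢SHA ψ → Λ ∣ Γ ⊢SHA φ ∨' ψ
  s∀L   : ∀ {Λ Γ φ δ} (t : Term 0) → WF Λ (∀' φ ∷ Γ) δ →
          Λ ∣ inst φ t ∷ Γ ⊢SHA δ → Λ ∣ ∀' φ ∷ Γ ⊢SHA δ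
  s∀R   : ∀ {Λ Γ φ} (y : ℕ) → y ∉ fvSeq Γ (∀' φ) → y ∉ VarS Λ →
          WF Λ Γ (∀' φ) →
          Λ ∣ Γ ⊢SHA inst φ (var y) → Λ ∣ Γ ⊢SHA ∀' φ
  s∃L   : ∀ {Λ Γ φ δ} (y : ℕ) → y ∉ fvSeq (∃' φ ∷ Γ) δ → y ∉ VarS Λ →
          WF Λ (∃' φ ∷ Γ) δ →
          Λ ∣ inst φ (var y) ∷ Γ ⊢SHA δ → Λ ∣ ∃' φ ∷ Γ ⊢SHA δ
  s∃R   : ∀ {Λ Γ φ} (t : Term 0) → WF Λ Γ (∃' φ) →
          Λ ∣ Γ ⊢SHA inst φ t → Λ ∣ Γ ⊢SHA ∃' φ
  s⊥L   : ∀ {Λ Γ δ} → WF Λ (⊥' ∷ Γ) δ → Λ ∣ ⊥' ∷ Γ ⊢SHA δ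
  s=L   : ∀ {Λ Γ δ} (x y : ℕ) (s t : Term 0) → x ≢ y →
          x ∉ fvT s → x ∉ fvT t → y ∉ fvT s → y ∉ fvT t →
          WF Λ ((s ≐ t) ∷ fsubC (update [ s / x ] y t) Γ)
               (fsubF (update [ s / x ] y t) δ) →
          Λ ∣ fsubC [ var x / y ] Γ ⊢SHA fsubF [ var x / y ] δ →
          Λ ∣ (s ≐ t) ∷ fsubC (update [ s / x ] y t) Γ
            ⊢SHA fsubF (update [ s / x ] y t) δ
  s=R   : ∀ {Λ Γ} (t : Term 0) → WF Λ Γ (t ≐ t) → Λ ∣ Γ ⊢SHA t ≐ t
  sWk   : ∀ {Λ Γ φ δ} → WF Λ (φ ∷ Γ) δ →
          Λ ∣ Γ ⊢SHA δ → Λ ∣ φ ∷ Γ ⊢SHA δ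
  sCut  : ∀ {Λ Γ φ δ} → WF Λ Γ δ →
          Λ ∣ Γ ⊢SHA φ → Λ ∣ φ ∷ Γ ⊢SHA δ → Λ ∣ Γ ⊢SHA δ
  sAx   : ∀ {Γ δ} → [] ∣ δ ∷ Γ ⊢SHA δ
  sA0S  : ∀ {Γ} (t : Term 0) → [] ∣ Γ ⊢SHA `0 ≠' `S t
  sASS  : ∀ {Γ} (s t : Term 0) → [] ∣ (`S s ≐ `S t) ∷ Γ ⊢SHA s ≐ t
  sA+0  : ∀ {Γ} (s : Term 0) → [] ∣ Γ ⊢SHA (s `+ `0) ≐ s
  sA+S  : ∀ {Γ} (s t : Term 0) → [] ∣ Γ ⊢SHA (s `+ `S t) ≐ `S (s `+ t)
  sA·0  : ∀ {Γ} (s : Term 0) → [] ∣ Γ ⊢SHA (s `· `0) ≐ `0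
  sA·S  : ∀ {Γ} (s t : Term 0) → [] ∣ Γ ⊢SHA (s `· `S t) ≐ ((s `· t) `+ s)
  sInd  : ∀ {Γ} (φ : Formula 1) (s : Term 0) →
          [] ∣ inst φ `0 ∷ ∀' (φ ⇒' instS φ) ∷ Γ ⊢SHA inst φ s
  sComp : ∀ {Λ Γ δ} (x : ℕ) (p : x ∈ fvSeq Γ δ) → WF Λ Γ δ →
          (Λ ︔ mkLabel x minus Γ δ p) ∣ Γ ⊢SHA δ → Λ ∣ Γ ⊢SHA δ
  sBud  : ∀ {Λ Γ δ} (x : ℕ) (p : x ∈ fvSeq Γ δ) →
          WF (Λ ︔ mkLabel x plus Γ δ p) Γ δ →
          (Λ ︔ mkLabel x plus Γ δ p) ∣ Γ ⊢SHA δ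
  sPop  : ∀ {Λ Λ' Γ δ} → Λ ∣ Γ ⊢SHA δ → (Λ ++ Λ') ∣ Γ ⊢SHA δ
  sCase : ∀ {Λ Γ δ} (x : ℕ) → WF Λ Γ δ →
          Λ ∣ fsubC [ `0 / x ] Γ ⊢SHA fsubF [ `0 / x ] δ →
          plusAt x Λ ∣ fsubC [ `S (var x) / x ] Γ ⊢SHA fsubF [ `S (var x) / x ] δ →
          Λ ∣ Γ ⊢SHA δ

SHA⊢ : Ctx → Formula 0 → Set
SHA⊢ Γ δ = [] ∣ Γ ⊢SHA δ

-- A derivation of Λ ∣ Γ ⇒ δ is translated into an HA derivation of Γ together with one
-- hypothesis per label of Λ. A label x^• ↦ Γ' ⇒ δ' pushed above labels with hypotheses A
-- determines the closed formula E(x) = ∀ȳ. Γ' → A → δ' (ȳ the other free variables);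
-- x^- contributes the hypothesis ∀w < x. E(w) and x^+ the hypothesis ∀w ≤ x. E(w).
-- Comp is then strong induction on x, Bud reads E(x) off the x^+ hypothesis, and Case is
-- an induction on x which turns ∀w < S x. E(w) into ∀w ≤ x. E(w), i.e. x^- into x^+.

module Submission where

open import Defs
open import Data.Nat using (ℕ; zero; suc)
open import Data.Nat.Properties using (_≟_; 1+n≰n)
open import Data.Fin using (Fin; zero; suc; fromℕ; inject₁)
open import Data.List using (List; []; _∷_; _++_; [_]; foldr; reverse; filter; zipWith)
open import Data.List.Properties using (++-identityʳ; map-++; concatMap-++; reverse-++; reverse-map)
open import Data.List.Extrema.Nat using (max; xs≤max)
open import Data.List.Membership.Propositional using (_∈_; _∉_)
open import Data.List.Membership.Propositional.Properties using (∈-++⁺ˡ; ∈-++⁺ʳ; ∈-++⁻; ∈-filter⁺; ∈-filter⁻)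
open import Data.List.Relation.Unary.All as All using (All; []; _∷_)
import Data.List.Relation.Unary.All.Properties as All
import Data.List.Relation.Unary.Any.Properties as Any
open import Data.List.Relation.Unary.Any using (here; there)
open import Data.List.Relation.Binary.Subset.Propositional using (_⊆_)
open import Data.List.Relation.Binary.Pointwise as Pointwise using (Pointwise; []; _∷_)
open import Data.List.Relation.Binary.Subset.Propositional.Properties using (xs⊆xs++ys; ⊆-reflexive-↭; ++⁺ˡ; ++⁺ʳ)
open import Data.List.Relation.Binary.Permutation.Propositional using (_↭_; ↭-sym)
open import Data.List.Relation.Binary.Permutation.Propositional.Properties using (shift)
open import Data.Product using (∃-syntax; _×_; _,_; proj₁; proj₂; map₁)
open import Data.Sum using (_⊎_; inj₁; inj₂; [_,_]′)
open import Data.Bool using (if_then_else_)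
open import Data.Empty using (⊥-elim)
open import Function using (_∘_; id)
open import Relation.Nullary using (yes; no; ¬?; does)
open import Relation.Nullary.Decidable using (dec-true; dec-false)
open import Relation.Binary.PropositionalEquality using (_≡_; _≢_; refl; sym; trans; cong; cong₂; subst; subst₂)

-- Substitution

embT-id : (t : Term 0) → embT t ≡ t
embT-id (var x)   = refl
embT-id (bvar ())
embT-id `0        = refl
embT-id (`S t)    = cong `S (embT-id t)
embT-id (s `+ t)  = cong₂ _`+_ (embT-id s) (embT-id t)
embT-id (s `· t)  = cong₂ _`·_ (embT-id s) (embT-id t)

renT-embT : ∀ {n m} (ρ : Fin n → Fin m) (t : Term 0) → renT ρ (embT t) ≡ embT t
renT-embT ρ (var x)   = refl
renT-embT ρ (bvar ())
renT-embT ρ `0        = refl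
renT-embT ρ (`S t)    = cong `S (renT-embT ρ t)
renT-embT ρ (s `+ t)  = cong₂ _`+_ (renT-embT ρ s) (renT-embT ρ t)
renT-embT ρ (s `· t)  = cong₂ _`·_ (renT-embT ρ s) (renT-embT ρ t)

bsubT-embT : ∀ {n m} (σ : Fin n → Term m) (t : Term 0) → bsubT σ (embT t) ≡ embT t
bsubT-embT σ (var x)   = refl
bsubT-embT σ (bvar ())
bsubT-embT σ `0        = refl
bsubT-embT σ (`S t)    = cong `S (bsubT-embT σ t)
bsubT-embT σ (s `+ t)  = cong₂ _`+_ (bsubT-embT σ s) (bsubT-embT σ t)
bsubT-embT σ (s `· t)  = cong₂ _`·_ (bsubT-embT σ s) (bsubT-embT σ t)

bsubT-embT-id : ∀ {n} (σ : Fin n → Term 0) (t : Term 0) → bsubT σ (embT t) ≡ t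
bsubT-embT-id σ t = trans (bsubT-embT σ t) (embT-id t)

fvT-embT : ∀ {n} (t : Term 0) → fvT {n} (embT t) ≡ fvT t
fvT-embT (var x)   = refl
fvT-embT (bvar ())
fvT-embT `0        = refl
fvT-embT (`S t)    = fvT-embT t
fvT-embT (s `+ t)  = cong₂ _++_ (fvT-embT s) (fvT-embT t)
fvT-embT (s `· t)  = cong₂ _++_ (fvT-embT s) (fvT-embT t)

bsubT-cong : ∀ {n m} {σ τ : Fin n → Term m} → (∀ i → σ i ≡ τ i) → ∀ t → bsubT σ t ≡ bsubT τ t
bsubT-cong σ≗τ (var x)   = refl
bsubT-cong σ≗τ (bvar i)  = σ≗τ i
bsubT-cong σ≗τ `0        = refl
bsubT-cong σ≗τ (`S t)    = cong `S (bsubT-cong σ≗τ t)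
bsubT-cong σ≗τ (s `+ t)  = cong₂ _`+_ (bsubT-cong σ≗τ s) (bsubT-cong σ≗τ t)
bsubT-cong σ≗τ (s `· t)  = cong₂ _`·_ (bsubT-cong σ≗τ s) (bsubT-cong σ≗τ t)

liftσ-cong : ∀ {n m} {σ τ : Fin n → Term m} → (∀ i → σ i ≡ τ i) → ∀ i → liftσ σ i ≡ liftσ τ i
liftσ-cong σ≗τ zero    = refl
liftσ-cong σ≗τ (suc i) = cong (renT suc) (σ≗τ i)

bsubF-cong : ∀ {n m} {σ τ : Fin n → Term m} → (∀ i → σ i ≡ τ i) → ∀ φ → bsubF σ φ ≡ bsubF τ φ
bsubF-cong σ≗τ (s ≐ t)   = cong₂ _≐_ (bsubT-cong σ≗τ s) (bsubT-cong σ≗τ t)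
bsubF-cong σ≗τ ⊥'        = refl
bsubF-cong σ≗τ (φ ∧' ψ)  = cong₂ _∧'_ (bsubF-cong σ≗τ φ) (bsubF-cong σ≗τ ψ)
bsubF-cong σ≗τ (φ ∨' ψ)  = cong₂ _∨'_ (bsubF-cong σ≗τ φ) (bsubF-cong σ≗τ ψ)
bsubF-cong σ≗τ (φ ⇒' ψ)  = cong₂ _⇒'_ (bsubF-cong σ≗τ φ) (bsubF-cong σ≗τ ψ)
bsubF-cong σ≗τ (∀' φ)    = cong ∀' (bsubF-cong (liftσ-cong σ≗τ) φ)
bsubF-cong σ≗τ (∃' φ)    = cong ∃' (bsubF-cong (liftσ-cong σ≗τ) φ)

bsubT-renT : ∀ {n m k} (ρ : Fin n → Fin m) (σ : Fin m → Term k) t → bsubT σ (renT ρ t) ≡ bsubT (σ ∘ ρ) t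
bsubT-renT ρ σ (var x)   = refl
bsubT-renT ρ σ (bvar i)  = refl
bsubT-renT ρ σ `0        = refl
bsubT-renT ρ σ (`S t)    = cong `S (bsubT-renT ρ σ t)
bsubT-renT ρ σ (s `+ t)  = cong₂ _`+_ (bsubT-renT ρ σ s) (bsubT-renT ρ σ t)
bsubT-renT ρ σ (s `· t)  = cong₂ _`·_ (bsubT-renT ρ σ s) (bsubT-renT ρ σ t)

renT-bsubT : ∀ {n m k} (σ : Fin n → Term m) (ρ : Fin m → Fin k) t → renT ρ (bsubT σ t) ≡ bsubT (renT ρ ∘ σ) t
renT-bsubT σ ρ (var x)   = refl
renT-bsubT σ ρ (bvar i)  = refl
renT-bsubT σ ρ `0        = refl
renT-bsubT σ ρ (`S t)    = cong `S (renT-bsubT σ ρ t)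
renT-bsubT σ ρ (s `+ t)  = cong₂ _`+_ (renT-bsubT σ ρ s) (renT-bsubT σ ρ t)
renT-bsubT σ ρ (s `· t)  = cong₂ _`·_ (renT-bsubT σ ρ s) (renT-bsubT σ ρ t)

bsubT-bsubT : ∀ {n m k} (σ : Fin n → Term m) (τ : Fin m → Term k) t → bsubT τ (bsubT σ t) ≡ bsubT (bsubT τ ∘ σ) t
bsubT-bsubT σ τ (var x)   = refl
bsubT-bsubT σ τ (bvar i)  = refl
bsubT-bsubT σ τ `0        = refl
bsubT-bsubT σ τ (`S t)    = cong `S (bsubT-bsubT σ τ t)
bsubT-bsubT σ τ (s `+ t)  = cong₂ _`+_ (bsubT-bsubT σ τ s) (bsubT-bsubT σ τ t)
bsubT-bsubT σ τ (s `· t)  = cong₂ _`·_ (bsubT-bsubT σ τ s) (bsubT-bsubT σ τ t)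

liftσ-bsubT : ∀ {n m k} (σ : Fin n → Term m) (τ : Fin m → Term k) →
              ∀ i → bsubT (liftσ τ) (liftσ σ i) ≡ liftσ (bsubT τ ∘ σ) i
liftσ-bsubT σ τ zero    = refl
liftσ-bsubT σ τ (suc i) = trans (bsubT-renT suc (liftσ τ) (σ i)) (sym (renT-bsubT τ suc (σ i)))

bsubF-bsubF : ∀ {n m k} (σ : Fin n → Term m) (τ : Fin m → Term k) φ → bsubF τ (bsubF σ φ) ≡ bsubF (bsubT τ ∘ σ) φ
bsubF-bsubF σ τ (s ≐ t)   = cong₂ _≐_ (bsubT-bsubT σ τ s) (bsubT-bsubT σ τ t)
bsubF-bsubF σ τ ⊥'        = refl
bsubF-bsubF σ τ (φ ∧' ψ)  = cong₂ _∧'_ (bsubF-bsubF σ τ φ) (bsubF-bsubF σ τ ψ)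
bsubF-bsubF σ τ (φ ∨' ψ)  = cong₂ _∨'_ (bsubF-bsubF σ τ φ) (bsubF-bsubF σ τ ψ)
bsubF-bsubF σ τ (φ ⇒' ψ)  = cong₂ _⇒'_ (bsubF-bsubF σ τ φ) (bsubF-bsubF σ τ ψ)
bsubF-bsubF σ τ (∀' φ)    = cong ∀' (trans (bsubF-bsubF (liftσ σ) (liftσ τ) φ) (bsubF-cong (liftσ-bsubT σ τ) φ))
bsubF-bsubF σ τ (∃' φ)    = cong ∃' (trans (bsubF-bsubF (liftσ σ) (liftσ τ) φ) (bsubF-cong (liftσ-bsubT σ τ) φ))

bsubT-bvar : ∀ {n} (t : Term n) → bsubT bvar t ≡ t
bsubT-bvar (var x)   = refl
bsubT-bvar (bvar i)  = refl
bsubT-bvar `0        = refl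
bsubT-bvar (`S t)    = cong `S (bsubT-bvar t)
bsubT-bvar (s `+ t)  = cong₂ _`+_ (bsubT-bvar s) (bsubT-bvar t)
bsubT-bvar (s `· t)  = cong₂ _`·_ (bsubT-bvar s) (bsubT-bvar t)

liftσ-bvar : ∀ {n} (i : Fin (suc n)) → liftσ bvar i ≡ bvar i
liftσ-bvar zero    = refl
liftσ-bvar (suc i) = refl

bsubF-bvar : ∀ {n} (φ : Formula n) → bsubF bvar φ ≡ φ
bsubF-bvar (s ≐ t)   = cong₂ _≐_ (bsubT-bvar s) (bsubT-bvar t)
bsubF-bvar ⊥'        = refl
bsubF-bvar (φ ∧' ψ)  = cong₂ _∧'_ (bsubF-bvar φ) (bsubF-bvar ψ)
bsubF-bvar (φ ∨' ψ)  = cong₂ _∨'_ (bsubF-bvar φ) (bsubF-bvar ψ)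
bsubF-bvar (φ ⇒' ψ)  = cong₂ _⇒'_ (bsubF-bvar φ) (bsubF-bvar ψ)
bsubF-bvar (∀' φ)    = cong ∀' (trans (bsubF-cong liftσ-bvar φ) (bsubF-bvar φ))
bsubF-bvar (∃' φ)    = cong ∃' (trans (bsubF-cong liftσ-bvar φ) (bsubF-bvar φ))

inst-instS : (φ : Formula 1) (t : Term 0) → inst (instS φ) t ≡ inst φ (`S t)
inst-instS φ t = trans (bsubF-bsubF _ _ φ) (bsubF-cong (λ _ → refl) φ)

fsubT-renT : ∀ {n m} (σ : FSub) (ρ : Fin n → Fin m) t → fsubT σ (renT ρ t) ≡ renT ρ (fsubT σ t)
fsubT-renT σ ρ (var x)   = sym (renT-embT ρ (σ x))
fsubT-renT σ ρ (bvar i)  = refl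
fsubT-renT σ ρ `0        = refl
fsubT-renT σ ρ (`S t)    = cong `S (fsubT-renT σ ρ t)
fsubT-renT σ ρ (s `+ t)  = cong₂ _`+_ (fsubT-renT σ ρ s) (fsubT-renT σ ρ t)
fsubT-renT σ ρ (s `· t)  = cong₂ _`·_ (fsubT-renT σ ρ s) (fsubT-renT σ ρ t)

fsubT-bsubT : ∀ {n m} (σ : FSub) (τ : Fin n → Term m) t →
              fsubT σ (bsubT τ t) ≡ bsubT (fsubT σ ∘ τ) (fsubT σ t)
fsubT-bsubT σ τ (var x)   = sym (bsubT-embT _ (σ x))
fsubT-bsubT σ τ (bvar i)  = refl
fsubT-bsubT σ τ `0        = refl
fsubT-bsubT σ τ (`S t)    = cong `S (fsubT-bsubT σ τ t)
fsubT-bsubT σ τ (s `+ t)  = cong₂ _`+_ (fsubT-bsubT σ τ s) (fsubT-bsubT σ τ t)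
fsubT-bsubT σ τ (s `· t)  = cong₂ _`·_ (fsubT-bsubT σ τ s) (fsubT-bsubT σ τ t)

fsubT-liftσ : ∀ {n m} (σ : FSub) (τ : Fin n → Term m) → ∀ i → fsubT σ (liftσ τ i) ≡ liftσ (fsubT σ ∘ τ) i
fsubT-liftσ σ τ zero    = refl
fsubT-liftσ σ τ (suc i) = fsubT-renT σ suc (τ i)

fsubF-bsubF : ∀ {n m} (σ : FSub) (τ : Fin n → Term m) φ →
              fsubF σ (bsubF τ φ) ≡ bsubF (fsubT σ ∘ τ) (fsubF σ φ)
fsubF-bsubF σ τ (s ≐ t)   = cong₂ _≐_ (fsubT-bsubT σ τ s) (fsubT-bsubT σ τ t)
fsubF-bsubF σ τ ⊥'        = refl
fsubF-bsubF σ τ (φ ∧' ψ)  = cong₂ _∧'_ (fsubF-bsubF σ τ φ) (fsubF-bsubF σ τ ψ)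
fsubF-bsubF σ τ (φ ∨' ψ)  = cong₂ _∨'_ (fsubF-bsubF σ τ φ) (fsubF-bsubF σ τ ψ)
fsubF-bsubF σ τ (φ ⇒' ψ)  = cong₂ _⇒'_ (fsubF-bsubF σ τ φ) (fsubF-bsubF σ τ ψ)
fsubF-bsubF σ τ (∀' φ)    = cong ∀' (trans (fsubF-bsubF σ (liftσ τ) φ) (bsubF-cong (fsubT-liftσ σ τ) (fsubF σ φ)))
fsubF-bsubF σ τ (∃' φ)    = cong ∃' (trans (fsubF-bsubF σ (liftσ τ) φ) (bsubF-cong (fsubT-liftσ σ τ) (fsubF σ φ)))

fsubF-inst : (σ : FSub) (φ : Formula 1) (t : Term 0) → fsubF σ (inst φ t) ≡ inst (fsubF σ φ) (fsubT σ t)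
fsubF-inst σ φ t = fsubF-bsubF σ (λ _ → t) φ

fsubT-cong : ∀ {n} {σ σ' : FSub} (t : Term n) → (∀ {y} → y ∈ fvT t → σ y ≡ σ' y) → fsubT σ t ≡ fsubT σ' t
fsubT-cong (var x)   σ≗σ' = cong embT (σ≗σ' (here refl))
fsubT-cong (bvar i)  σ≗σ' = refl
fsubT-cong `0        σ≗σ' = refl
fsubT-cong (`S t)    σ≗σ' = cong `S (fsubT-cong t σ≗σ')
fsubT-cong (s `+ t)  σ≗σ' = cong₂ _`+_ (fsubT-cong s (σ≗σ' ∘ ∈-++⁺ˡ)) (fsubT-cong t (σ≗σ' ∘ ∈-++⁺ʳ _))
fsubT-cong (s `· t)  σ≗σ' = cong₂ _`·_ (fsubT-cong s (σ≗σ' ∘ ∈-++⁺ˡ)) (fsubT-cong t (σ≗σ' ∘ ∈-++⁺ʳ _))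

fsubF-cong : ∀ {n} {σ σ' : FSub} (φ : Formula n) → (∀ {y} → y ∈ fvF φ → σ y ≡ σ' y) → fsubF σ φ ≡ fsubF σ' φ
fsubF-cong (s ≐ t)   σ≗σ' = cong₂ _≐_ (fsubT-cong s (σ≗σ' ∘ ∈-++⁺ˡ)) (fsubT-cong t (σ≗σ' ∘ ∈-++⁺ʳ _))
fsubF-cong ⊥'        σ≗σ' = refl
fsubF-cong (φ ∧' ψ)  σ≗σ' = cong₂ _∧'_ (fsubF-cong φ (σ≗σ' ∘ ∈-++⁺ˡ)) (fsubF-cong ψ (σ≗σ' ∘ ∈-++⁺ʳ _))
fsubF-cong (φ ∨' ψ)  σ≗σ' = cong₂ _∨'_ (fsubF-cong φ (σ≗σ' ∘ ∈-++⁺ˡ)) (fsubF-cong ψ (σ≗σ' ∘ ∈-++⁺ʳ _))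
fsubF-cong (φ ⇒' ψ)  σ≗σ' = cong₂ _⇒'_ (fsubF-cong φ (σ≗σ' ∘ ∈-++⁺ˡ)) (fsubF-cong ψ (σ≗σ' ∘ ∈-++⁺ʳ _))
fsubF-cong (∀' φ)    σ≗σ' = cong ∀' (fsubF-cong φ σ≗σ')
fsubF-cong (∃' φ)    σ≗σ' = cong ∃' (fsubF-cong φ σ≗σ')

fsubT-var : ∀ {n} (t : Term n) → fsubT var t ≡ t
fsubT-var (var x)   = refl
fsubT-var (bvar i)  = refl
fsubT-var `0        = refl
fsubT-var (`S t)    = cong `S (fsubT-var t)
fsubT-var (s `+ t)  = cong₂ _`+_ (fsubT-var s) (fsubT-var t)
fsubT-var (s `· t)  = cong₂ _`·_ (fsubT-var s) (fsubT-var t)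

fsubF-var : ∀ {n} (φ : Formula n) → fsubF var φ ≡ φ
fsubF-var (s ≐ t)   = cong₂ _≐_ (fsubT-var s) (fsubT-var t)
fsubF-var ⊥'        = refl
fsubF-var (φ ∧' ψ)  = cong₂ _∧'_ (fsubF-var φ) (fsubF-var ψ)
fsubF-var (φ ∨' ψ)  = cong₂ _∨'_ (fsubF-var φ) (fsubF-var ψ)
fsubF-var (φ ⇒' ψ)  = cong₂ _⇒'_ (fsubF-var φ) (fsubF-var ψ)
fsubF-var (∀' φ)    = cong ∀' (fsubF-var φ)
fsubF-var (∃' φ)    = cong ∃' (fsubF-var φ)

fsubF-id : ∀ {n} {σ : FSub} (φ : Formula n) → (∀ {y} → y ∈ fvF φ → σ y ≡ var y) → fsubF σ φ ≡ φ
fsubF-id φ σ≗var = trans (fsubF-cong φ σ≗var) (fsubF-var φ)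

fsubC-id : ∀ {σ : FSub} Γ → (∀ {y} → y ∈ fvC Γ → σ y ≡ var y) → fsubC σ Γ ≡ Γ
fsubC-id []      σ≗var = refl
fsubC-id (φ ∷ Γ) σ≗var = cong₂ _∷_ (fsubF-id φ (σ≗var ∘ ∈-++⁺ˡ)) (fsubC-id Γ (σ≗var ∘ ∈-++⁺ʳ _))

update-≡ : ∀ σ x t → update σ x t x ≡ t
update-≡ σ x t rewrite dec-true (x ≟ x) refl = refl

update-≢ : ∀ σ {x y} t → y ≢ x → update σ x t y ≡ σ y
update-≢ σ {x} {y} t y≢x rewrite dec-false (y ≟ x) y≢x = refl

-- Free variables

Closed : ∀ {n} → Formula n → Set
Closed φ = ∀ y → y ∉ fvF φ

fvT-renT : ∀ {n m} (ρ : Fin n → Fin m) t → fvT (renT ρ t) ≡ fvT t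
fvT-renT ρ (var x)   = refl
fvT-renT ρ (bvar i)  = refl
fvT-renT ρ `0        = refl
fvT-renT ρ (`S t)    = fvT-renT ρ t
fvT-renT ρ (s `+ t)  = cong₂ _++_ (fvT-renT ρ s) (fvT-renT ρ t)
fvT-renT ρ (s `· t)  = cong₂ _++_ (fvT-renT ρ s) (fvT-renT ρ t)

fvT-bsubT : ∀ {n m} {σ : Fin n → Term m} → (∀ i → fvT (σ i) ≡ []) → ∀ t → fvT (bsubT σ t) ≡ fvT t
fvT-bsubT σ-closed (var x)   = refl
fvT-bsubT σ-closed (bvar i)  = σ-closed i
fvT-bsubT σ-closed `0        = refl
fvT-bsubT σ-closed (`S t)    = fvT-bsubT σ-closed t
fvT-bsubT σ-closed (s `+ t)  = cong₂ _++_ (fvT-bsubT σ-closed s) (fvT-bsubT σ-closed t)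
fvT-bsubT σ-closed (s `· t)  = cong₂ _++_ (fvT-bsubT σ-closed s) (fvT-bsubT σ-closed t)

fvT-liftσ : ∀ {n m} {σ : Fin n → Term m} → (∀ i → fvT (σ i) ≡ []) → ∀ i → fvT (liftσ σ i) ≡ []
fvT-liftσ σ-closed zero            = refl
fvT-liftσ {σ = σ} σ-closed (suc i) = trans (fvT-renT suc (σ i)) (σ-closed i)

fvF-bsubF : ∀ {n m} {σ : Fin n → Term m} → (∀ i → fvT (σ i) ≡ []) → ∀ φ → fvF (bsubF σ φ) ≡ fvF φ
fvF-bsubF σ-closed (s ≐ t)   = cong₂ _++_ (fvT-bsubT σ-closed s) (fvT-bsubT σ-closed t)
fvF-bsubF σ-closed ⊥'        = refl
fvF-bsubF σ-closed (φ ∧' ψ)  = cong₂ _++_ (fvF-bsubF σ-closed φ) (fvF-bsubF σ-closed ψ)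
fvF-bsubF σ-closed (φ ∨' ψ)  = cong₂ _++_ (fvF-bsubF σ-closed φ) (fvF-bsubF σ-closed ψ)
fvF-bsubF σ-closed (φ ⇒' ψ)  = cong₂ _++_ (fvF-bsubF σ-closed φ) (fvF-bsubF σ-closed ψ)
fvF-bsubF σ-closed (∀' φ)    = fvF-bsubF (fvT-liftσ σ-closed) φ
fvF-bsubF σ-closed (∃' φ)    = fvF-bsubF (fvT-liftσ σ-closed) φ

fvF-instS : (φ : Formula 1) → fvF (instS φ) ≡ fvF φ
fvF-instS = fvF-bsubF (λ _ → refl)

∉-fvT-fsubT : ∀ {n v} {σ : FSub} → (∀ z → v ∉ fvT (σ z)) → (t : Term n) → v ∉ fvT (fsubT σ t)
∉-fvT-fsubT {σ = σ} σ-avoids (var x) = σ-avoids x ∘ subst (_ ∈_) (fvT-embT (σ x))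
∉-fvT-fsubT σ-avoids (bvar i) ()
∉-fvT-fsubT σ-avoids `0       ()
∉-fvT-fsubT σ-avoids (`S t)   = ∉-fvT-fsubT σ-avoids t
∉-fvT-fsubT σ-avoids (s `+ t) = [ ∉-fvT-fsubT σ-avoids s , ∉-fvT-fsubT σ-avoids t ]′ ∘ ∈-++⁻ _
∉-fvT-fsubT σ-avoids (s `· t) = [ ∉-fvT-fsubT σ-avoids s , ∉-fvT-fsubT σ-avoids t ]′ ∘ ∈-++⁻ _

∉-fvF-fsubF : ∀ {n v} {σ : FSub} → (∀ z → v ∉ fvT (σ z)) → (φ : Formula n) → v ∉ fvF (fsubF σ φ)
∉-fvF-fsubF σ-avoids (s ≐ t)  = [ ∉-fvT-fsubT σ-avoids s , ∉-fvT-fsubT σ-avoids t ]′ ∘ ∈-++⁻ _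
∉-fvF-fsubF σ-avoids ⊥'       ()
∉-fvF-fsubF σ-avoids (φ ∧' ψ) = [ ∉-fvF-fsubF σ-avoids φ , ∉-fvF-fsubF σ-avoids ψ ]′ ∘ ∈-++⁻ _
∉-fvF-fsubF σ-avoids (φ ∨' ψ) = [ ∉-fvF-fsubF σ-avoids φ , ∉-fvF-fsubF σ-avoids ψ ]′ ∘ ∈-++⁻ _
∉-fvF-fsubF σ-avoids (φ ⇒' ψ) = [ ∉-fvF-fsubF σ-avoids φ , ∉-fvF-fsubF σ-avoids ψ ]′ ∘ ∈-++⁻ _
∉-fvF-fsubF σ-avoids (∀' φ)   = ∉-fvF-fsubF σ-avoids φ
∉-fvF-fsubF σ-avoids (∃' φ)   = ∉-fvF-fsubF σ-avoids φ

∉-fvC-fsubC : ∀ {v} {σ : FSub} → (∀ z → v ∉ fvT (σ z)) → (Γ : Ctx) → v ∉ fvC (fsubC σ Γ)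
∉-fvC-fsubC σ-avoids []      ()
∉-fvC-fsubC σ-avoids (φ ∷ Γ) = [ ∉-fvF-fsubF σ-avoids φ , ∉-fvC-fsubC σ-avoids Γ ]′ ∘ ∈-++⁻ _

∉-fvT-update : ∀ {v} σ y t z → v ∉ fvT t → (z ≢ y → v ∉ fvT (σ z)) → v ∉ fvT (update σ y t z)
∉-fvT-update σ y t z v∉t σz-avoids with z ≟ y
... | yes refl = subst (λ u → _ ∉ fvT u) (sym (update-≡ σ z t)) v∉t
... | no z≢y   = subst (λ u → _ ∉ fvT u) (sym (update-≢ σ t z≢y)) (σz-avoids z≢y)

fsubF-[0/x]-idem : ∀ x (φ : Formula 0) → fsubF [ `0 / x ] (fsubF [ `0 / x ] φ) ≡ fsubF [ `0 / x ] φ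
fsubF-[0/x]-idem x φ = fsubF-id (fsubF [ `0 / x ] φ) λ y∈ → update-≢ var `0 λ { refl → ∉-fvF-fsubF [0/x]-avoids φ y∈ }
  where
  [0/x]-avoids : ∀ z → x ∉ fvT ([ `0 / x ] z)
  [0/x]-avoids z = ∉-fvT-update var x `0 z (λ ()) λ { z≢x (here refl) → z≢x refl }

fsubC-[0/x]-idem : ∀ x Γ → fsubC [ `0 / x ] (fsubC [ `0 / x ] Γ) ≡ fsubC [ `0 / x ] Γ
fsubC-[0/x]-idem x []      = refl
fsubC-[0/x]-idem x (φ ∷ Γ) = cong₂ _∷_ (fsubF-[0/x]-idem x φ) (fsubC-[0/x]-idem x Γ)

fresh : List ℕ → ℕ
fresh xs = suc (max 0 xs)

fresh-∉ : ∀ xs → fresh xs ∉ xs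
fresh-∉ xs p = 1+n≰n (All.lookup (xs≤max 0 xs) p)

-- Abstraction of a free variable

-- x becomes the outermost bound variable, which in scope suc n has index fromℕ n.
absT : ∀ {n} → ℕ → Term n → Term (suc n)
absT {n} x (var y) with y ≟ x
... | yes _ = bvar (fromℕ n)
... | no  _ = var y
absT x (bvar i)  = bvar (inject₁ i)
absT x `0        = `0
absT x (`S t)    = `S (absT x t)
absT x (s `+ t)  = absT x s `+ absT x t
absT x (s `· t)  = absT x s `· absT x t

absF : ∀ {n} → ℕ → Formula n → Formula (suc n)
absF x (s ≐ t)   = absT x s ≐ absT x t
absF x ⊥'        = ⊥'
absF x (φ ∧' ψ)  = absF x φ ∧' absF x ψ
absF x (φ ∨' ψ)  = absF x φ ∨' absF x ψ
absF x (φ ⇒' ψ)  = absF x φ ⇒' absF x ψ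
absF x (∀' φ)    = ∀' (absF x φ)
absF x (∃' φ)    = ∃' (absF x φ)

Instantiates : ∀ {n} → Term 0 → (Fin (suc n) → Term n) → Set
Instantiates {n} u σ = (∀ i → σ (inject₁ i) ≡ bvar i) × σ (fromℕ n) ≡ embT u

liftσ-instantiates : ∀ {n} {σ : Fin (suc n) → Term n} u → Instantiates u σ → Instantiates u (liftσ σ)
liftσ-instantiates u (σ-inner , σ-outer) = inner , trans (cong (renT suc) σ-outer) (renT-embT suc u)
  where
  inner : ∀ i → liftσ _ (inject₁ i) ≡ bvar i
  inner zero    = refl
  inner (suc i) = cong (renT suc) (σ-inner i)

bsubT-absT : ∀ {n} x {σ : Fin (suc n) → Term n} u → Instantiates u σ → ∀ t → bsubT σ (absT x t) ≡ fsubT [ u / x ] t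
bsubT-absT x u (σ-inner , σ-outer) (var y) with y ≟ x
... | yes refl = trans σ-outer (cong embT (sym (update-≡ var y u)))
... | no y≢x   = cong embT (sym (update-≢ var u y≢x))
bsubT-absT x u σ-inst (bvar i)  = proj₁ σ-inst i
bsubT-absT x u σ-inst `0        = refl
bsubT-absT x u σ-inst (`S t)    = cong `S (bsubT-absT x u σ-inst t)
bsubT-absT x u σ-inst (s `+ t)  = cong₂ _`+_ (bsubT-absT x u σ-inst s) (bsubT-absT x u σ-inst t)
bsubT-absT x u σ-inst (s `· t)  = cong₂ _`·_ (bsubT-absT x u σ-inst s) (bsubT-absT x u σ-inst t)

bsubF-absF : ∀ {n} x {σ : Fin (suc n) → Term n} u → Instantiates u σ → ∀ φ → bsubF σ (absF x φ) ≡ fsubF [ u / x ] φ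
bsubF-absF x u σ-inst (s ≐ t)  = cong₂ _≐_ (bsubT-absT x u σ-inst s) (bsubT-absT x u σ-inst t)
bsubF-absF x u σ-inst ⊥'       = refl
bsubF-absF x u σ-inst (φ ∧' ψ) = cong₂ _∧'_ (bsubF-absF x u σ-inst φ) (bsubF-absF x u σ-inst ψ)
bsubF-absF x u σ-inst (φ ∨' ψ) = cong₂ _∨'_ (bsubF-absF x u σ-inst φ) (bsubF-absF x u σ-inst ψ)
bsubF-absF x u σ-inst (φ ⇒' ψ) = cong₂ _⇒'_ (bsubF-absF x u σ-inst φ) (bsubF-absF x u σ-inst ψ)
bsubF-absF x u σ-inst (∀' φ)   = cong ∀' (bsubF-absF x u (liftσ-instantiates u σ-inst) φ)
bsubF-absF x u σ-inst (∃' φ)   = cong ∃' (bsubF-absF x u (liftσ-instantiates u σ-inst) φ)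

inst-absF : ∀ x (φ : Formula 0) u → inst (absF x φ) u ≡ fsubF [ u / x ] φ
inst-absF x φ u = bsubF-absF x u ((λ ()) , sym (embT-id u)) φ

fsubF-[x/x] : ∀ {n} x (φ : Formula n) → fsubF [ var x / x ] φ ≡ φ
fsubF-[x/x] x φ = fsubF-id φ (λ _ → [x/x]-id _)
  where
  [x/x]-id : ∀ y → [ var x / x ] y ≡ var y
  [x/x]-id y with y ≟ x
  ... | yes refl = update-≡ var y (var y)
  ... | no y≢x   = update-≢ var (var x) y≢x

inst-absF-var : ∀ x (φ : Formula 0) → inst (absF x φ) (var x) ≡ φ
inst-absF-var x φ = trans (inst-absF x φ (var x)) (fsubF-[x/x] x φ)

∈-fvT-absT⁻ : ∀ {n} x (t : Term n) {y} → y ∈ fvT (absT x t) → y ∈ fvT t × y ≢ x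
∈-fvT-absT⁻ x (var z) p with z ≟ x
∈-fvT-absT⁻ x (var z) ()          | yes _
∈-fvT-absT⁻ x (var z) (here refl) | no z≢x = here refl , z≢x
∈-fvT-absT⁻ x (bvar i) ()
∈-fvT-absT⁻ x `0       ()
∈-fvT-absT⁻ x (`S t)   p = ∈-fvT-absT⁻ x t p
∈-fvT-absT⁻ x (s `+ t) p = [ map₁ ∈-++⁺ˡ ∘ ∈-fvT-absT⁻ x s , map₁ (∈-++⁺ʳ _) ∘ ∈-fvT-absT⁻ x t ]′ (∈-++⁻ _ p)
∈-fvT-absT⁻ x (s `· t) p = [ map₁ ∈-++⁺ˡ ∘ ∈-fvT-absT⁻ x s , map₁ (∈-++⁺ʳ _) ∘ ∈-fvT-absT⁻ x t ]′ (∈-++⁻ _ p)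

∈-fvF-absF⁻ : ∀ {n} x (φ : Formula n) {y} → y ∈ fvF (absF x φ) → y ∈ fvF φ × y ≢ x
∈-fvF-absF⁻ x (s ≐ t)  p = [ map₁ ∈-++⁺ˡ ∘ ∈-fvT-absT⁻ x s , map₁ (∈-++⁺ʳ _) ∘ ∈-fvT-absT⁻ x t ]′ (∈-++⁻ _ p)
∈-fvF-absF⁻ x ⊥'       ()
∈-fvF-absF⁻ x (φ ∧' ψ) p = [ map₁ ∈-++⁺ˡ ∘ ∈-fvF-absF⁻ x φ , map₁ (∈-++⁺ʳ _) ∘ ∈-fvF-absF⁻ x ψ ]′ (∈-++⁻ _ p)
∈-fvF-absF⁻ x (φ ∨' ψ) p = [ map₁ ∈-++⁺ˡ ∘ ∈-fvF-absF⁻ x φ , map₁ (∈-++⁺ʳ _) ∘ ∈-fvF-absF⁻ x ψ ]′ (∈-++⁻ _ p)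
∈-fvF-absF⁻ x (φ ⇒' ψ) p = [ map₁ ∈-++⁺ˡ ∘ ∈-fvF-absF⁻ x φ , map₁ (∈-++⁺ʳ _) ∘ ∈-fvF-absF⁻ x ψ ]′ (∈-++⁻ _ p)
∈-fvF-absF⁻ x (∀' φ)   p = ∈-fvF-absF⁻ x φ p
∈-fvF-absF⁻ x (∃' φ)   p = ∈-fvF-absF⁻ x φ p

absF-fresh : ∀ {n} x (φ : Formula n) → x ∉ fvF (absF x φ)
absF-fresh x φ p = proj₂ (∈-fvF-absF⁻ x φ p) refl

closeAll : List ℕ → Formula 0 → Formula 0
closeAll []       φ = φ
closeAll (y ∷ ys) φ = ∀' (absF y (closeAll ys φ))

∈-fvF-closeAll⁻ : ∀ ys φ {z} → z ∈ fvF (closeAll ys φ) → z ∈ fvF φ × z ∉ ys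
∈-fvF-closeAll⁻ []       φ p = p , λ ()
∈-fvF-closeAll⁻ (y ∷ ys) φ p with ∈-fvF-absF⁻ y (closeAll ys φ) p
... | q , z≢y with ∈-fvF-closeAll⁻ ys φ q
...   | r , z∉ys = r , λ { (here z≡y) → z≢y z≡y ; (there z∈ys) → z∉ys z∈ys }

-- Derived rules of HA

weaken : ∀ {Γ Γ' δ} → Γ ⊆ Γ' → Γ ⊢HA δ → Γ' ⊢HA δ
weaken {Γ} {Γ'} {δ} Γ⊆Γ' d = hSet (λ p → [ id , Γ⊆Γ' ]′ (∈-++⁻ Γ' p)) (xs⊆xs++ys Γ' Γ) (prefix Γ')
  where
  prefix : ∀ Δ → Δ ++ Γ ⊢HA δ
  prefix []      = d
  prefix (φ ∷ Δ) = hWk (prefix Δ)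

permute : ∀ {Γ Γ' δ} → Γ ↭ Γ' → Γ ⊢HA δ → Γ' ⊢HA δ
permute = weaken ∘ ⊆-reflexive-↭

assumption : ∀ {Γ φ} → φ ∈ Γ → Γ ⊢HA φ
assumption φ∈Γ = weaken (λ { (here refl) → φ∈Γ ; (there ()) }) (hAx {Γ = []})

⇒-elim : ∀ {Γ φ ψ} → Γ ⊢HA φ ⇒' ψ → Γ ⊢HA φ → Γ ⊢HA ψ
⇒-elim d e = hCut e (hCut (hWk d) (h→L hAx hAx))

ex-falso : ∀ {Γ δ} → Γ ⊢HA ⊥' → Γ ⊢HA δ
ex-falso d = hCut d h⊥L

∨-elim : ∀ {Γ φ ψ δ} → Γ ⊢HA φ ∨' ψ → φ ∷ Γ ⊢HA δ → ψ ∷ Γ ⊢HA δ → Γ ⊢HA δ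
∨-elim d e f = hCut d (h∨L e f)

∀-elim : ∀ {Γ φ} → Γ ⊢HA ∀' φ → ∀ t → Γ ⊢HA inst φ t
∀-elim d t = hCut d (h∀L t hAx)

∀-intro : ∀ {Γ φ} → (∀ y → Γ ⊢HA inst φ (var y)) → Γ ⊢HA ∀' φ
∀-intro {Γ} {φ} d = h∀R _ (fresh-∉ (fvSeq Γ (∀' φ))) (d _)

∃-elim : ∀ {Γ φ δ} → Γ ⊢HA ∃' φ → (∀ y → inst φ (var y) ∷ Γ ⊢HA δ) → Γ ⊢HA δ
∃-elim {Γ} {φ} {δ} d e = hCut d (h∃L _ (fresh-∉ (fvSeq (∃' φ ∷ Γ) δ)) (e _))

infixr 5 _⇛_
_⇛_ : Ctx → Formula 0 → Formula 0
Δ ⇛ δ = foldr _⇒'_ δ Δ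

fsubF-⇛ : ∀ (σ : FSub) Δ δ → fsubF σ (Δ ⇛ δ) ≡ fsubC σ Δ ⇛ fsubF σ δ
fsubF-⇛ σ []      δ = refl
fsubF-⇛ σ (φ ∷ Δ) δ = cong (fsubF σ φ ⇒'_) (fsubF-⇛ σ Δ δ)

⇛-intro : ∀ {Γ δ} Δ → Γ ++ Δ ⊢HA δ → Γ ⊢HA Δ ⇛ δ
⇛-intro []          d = subst (_⊢HA _) (++-identityʳ _) d
⇛-intro {Γ} (φ ∷ Δ) d = h→R (⇛-intro Δ (permute (shift φ Γ Δ) d))

⇛-elim : ∀ {Γ δ} Δ → Γ ⊢HA Δ ⇛ δ → Γ ++ Δ ⊢HA δ
⇛-elim []          d = subst (_⊢HA _) (sym (++-identityʳ _)) d
⇛-elim {Γ} (φ ∷ Δ) d = permute (↭-sym (shift φ Γ Δ)) (⇛-elim Δ (⇒-elim (hWk d) hAx))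

⇛-apply : ∀ {Γ δ} Δ → Γ ⊢HA Δ ⇛ δ → All (Γ ⊢HA_) Δ → Γ ⊢HA δ
⇛-apply []      d []       = d
⇛-apply (φ ∷ Δ) d (e ∷ es) = ⇛-apply Δ (⇒-elim d e) es

cut-all : ∀ {Γ Δ δ} → Γ ++ Δ ⊢HA δ → All (Γ ⊢HA_) Δ → Γ ⊢HA δ
cut-all {Δ = Δ} d = ⇛-apply Δ (⇛-intro Δ d)

assumptions : ∀ {Γ Δ} → Δ ⊆ Γ → All (Γ ⊢HA_) Δ
assumptions Δ⊆Γ = All.tabulate (assumption ∘ Δ⊆Γ)

generalise : ∀ {φ} x → [] ⊢HA φ → [] ⊢HA ∀' (absF x φ)
generalise {φ} x d = h∀R x (absF-fresh x φ) (subst ([] ⊢HA_) (sym (inst-absF-var x φ)) d)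

-- Closing the sequent into a formula lets x be generalised and then instantiated by t.
⊢-fsub : ∀ {Γ δ} x t → Γ ⊢HA δ → fsubC [ t / x ] Γ ⊢HA fsubF [ t / x ] δ
⊢-fsub {Γ} {δ} x t d =
  ⇛-elim {[]} (fsubC [ t / x ] Γ) (subst ([] ⊢HA_) (trans (inst-absF x (Γ ⇛ δ) t) (fsubF-⇛ [ t / x ] Γ δ))
    (∀-elim (generalise x (⇛-intro {[]} Γ d)) t))

closeAll-intro : ∀ {Δ} ys φ → (∀ {y} → y ∈ ys → y ∉ fvC Δ) → Δ ⊢HA φ → Δ ⊢HA closeAll ys φ
closeAll-intro []           φ ys∉Δ d = d
closeAll-intro {Δ} (y ∷ ys) φ ys∉Δ d =
  h∀R y ([ ys∉Δ (here refl) , absF-fresh y (closeAll ys φ) ]′ ∘ ∈-++⁻ (fvC Δ))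
    (subst (Δ ⊢HA_) (sym (inst-absF-var y (closeAll ys φ))) (closeAll-intro ys φ (ys∉Δ ∘ there) d))

closeAll-elim : ∀ {Δ} ys φ → Δ ⊢HA closeAll ys φ → Δ ⊢HA φ
closeAll-elim []           φ d = d
closeAll-elim {Δ} (y ∷ ys) φ d = closeAll-elim ys φ (subst (Δ ⊢HA_) (inst-absF-var y (closeAll ys φ)) (∀-elim d (var y)))

-- Equality and induction

fsubF-inst-var : ∀ {σ : FSub} (F : Formula 1) z → (∀ {y} → y ∈ fvF F → σ y ≡ var y) →
                 fsubF σ (inst F (var z)) ≡ inst F (σ z)
fsubF-inst-var {σ} F z σ-fixes-F = trans (fsubF-inst σ F (var z)) (cong₂ inst (fsubF-id F σ-fixes-F) (embT-id (σ z)))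

-- =L on the sequent ⇒ F(a) → F(b) for fresh a and b: its premise, the case a = b, is trivial.
≐-subst-axiom : (F : Formula 1) (s t : Term 0) → (s ≐ t) ∷ [] ⊢HA inst F s ⇒' inst F t
≐-subst-axiom F s t =
  subst ((s ≐ t) ∷ [] ⊢HA_) conclusion (h=L a b s t a≢b (∉s a∉L) (∉t a∉L) (∉s b∉L) (∉t b∉L) premise)
  where
  L = fvF F ++ fvT s ++ fvT t
  a = fresh L
  b = fresh (a ∷ L)
  a∉L : a ∉ L
  a∉L = fresh-∉ L
  b∉L : b ∉ L
  b∉L = fresh-∉ (a ∷ L) ∘ there
  ∉F : ∀ {v} → v ∉ L → v ∉ fvF F
  ∉F v∉L = v∉L ∘ ∈-++⁺ˡ
  ∉s : ∀ {v} → v ∉ L → v ∉ fvT s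
  ∉s v∉L = v∉L ∘ ∈-++⁺ʳ (fvF F) ∘ ∈-++⁺ˡ
  ∉t : ∀ {v} → v ∉ L → v ∉ fvT t
  ∉t v∉L = v∉L ∘ ∈-++⁺ʳ (fvF F) ∘ ∈-++⁺ʳ (fvT s)
  a≢b : a ≢ b
  a≢b a≡b = fresh-∉ (a ∷ L) (here (sym a≡b))
  ≢-F : ∀ {v y} → v ∉ fvF F → y ∈ fvF F → y ≢ v
  ≢-F v∉F y∈F refl = v∉F y∈F
  σ = [ var a / b ]
  τ = update [ s / a ] b t
  σ-fixes-F : ∀ {y} → y ∈ fvF F → σ y ≡ var y
  σ-fixes-F y∈F = update-≢ var (var a) (≢-F (∉F b∉L) y∈F)
  premise : [] ⊢HA fsubF σ (inst F (var a) ⇒' inst F (var b))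
  premise = subst ([] ⊢HA_)
    (sym (cong₂ _⇒'_
      (trans (fsubF-inst-var F a σ-fixes-F) (cong (inst F) (update-≢ var (var a) a≢b)))
      (trans (fsubF-inst-var F b σ-fixes-F) (cong (inst F) (update-≡ var b (var a))))))
    (h→R hAx)
  τ-fixes-F : ∀ {y} → y ∈ fvF F → τ y ≡ var y
  τ-fixes-F y∈F = trans (update-≢ [ s / a ] t (≢-F (∉F b∉L) y∈F)) (update-≢ var s (≢-F (∉F a∉L) y∈F))
  conclusion : fsubF τ (inst F (var a) ⇒' inst F (var b)) ≡ (inst F s ⇒' inst F t)
  conclusion = cong₂ _⇒'_
    (trans (fsubF-inst-var F a τ-fixes-F) (cong (inst F) (trans (update-≢ [ s / a ] t a≢b) (update-≡ var a s))))
    (trans (fsubF-inst-var F b τ-fixes-F) (cong (inst F) (update-≡ [ s / a ] b t)))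

≐-subst : ∀ {Γ} (F : Formula 1) {s t} → Γ ⊢HA s ≐ t → Γ ⊢HA inst F s → Γ ⊢HA inst F t
≐-subst F {s} {t} s≐t Fs = ⇒-elim (hCut s≐t (weaken (λ { (here refl) → here refl ; (there ()) }) (≐-subst-axiom F s t))) Fs

≐-sym : ∀ {Γ s t} → Γ ⊢HA s ≐ t → Γ ⊢HA t ≐ s
≐-sym {Γ} {s} {t} s≐t = subst (λ u → Γ ⊢HA t ≐ u) (bsubT-embT-id _ s)
  (≐-subst (bvar zero ≐ embT s) s≐t (subst (λ u → Γ ⊢HA s ≐ u) (sym (bsubT-embT-id _ s)) (h=R s)))

≐-trans : ∀ {Γ r s t} → Γ ⊢HA r ≐ s → Γ ⊢HA s ≐ t → Γ ⊢HA r ≐ t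
≐-trans {Γ} {r} {s} {t} r≐s s≐t = subst (λ u → Γ ⊢HA u ≐ t) (bsubT-embT-id _ r)
  (≐-subst (embT r ≐ bvar zero) s≐t (subst (λ u → Γ ⊢HA u ≐ s) (sym (bsubT-embT-id _ r)) r≐s))

≐-cong-S : ∀ {Γ s t} → Γ ⊢HA s ≐ t → Γ ⊢HA `S s ≐ `S t
≐-cong-S {Γ} {s} {t} s≐t = subst (λ u → Γ ⊢HA `S u ≐ `S t) (bsubT-embT-id _ s)
  (≐-subst (`S (embT s) ≐ `S (bvar zero)) s≐t (subst (λ u → Γ ⊢HA `S u ≐ `S s) (sym (bsubT-embT-id _ s)) (h=R (`S s))))

S-injective : ∀ {Γ s t} → Γ ⊢HA `S s ≐ `S t → Γ ⊢HA s ≐ t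
S-injective Ss≐St = hCut Ss≐St (hASS _ _)

induction : ∀ {Γ} (φ : Formula 1) t → Γ ⊢HA inst φ `0 → Γ ⊢HA ∀' (φ ⇒' instS φ) → Γ ⊢HA inst φ t
induction φ t base step = hCut step (hCut (hWk base) (hInd φ t))

induction-at : ∀ x (φ : Formula 1) → x ∉ fvF φ →
               [] ⊢HA inst φ `0 → inst φ (var x) ∷ [] ⊢HA inst φ (`S (var x)) → [] ⊢HA inst φ (var x)
induction-at x φ x∉φ base step =
  induction φ (var x) base (h∀R x x∉step (subst ([] ⊢HA_) step≡ (h→R step)))
  where
  x∉step : x ∉ fvF (φ ⇒' instS φ)
  x∉step = [ x∉φ , x∉φ ∘ subst (x ∈_) (fvF-instS φ) ]′ ∘ ∈-++⁻ _
  step≡ : (inst φ (var x) ⇒' inst φ (`S (var x))) ≡ inst (φ ⇒' instS φ) (var x)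
  step≡ = cong (inst φ (var x) ⇒'_) (sym (inst-instS φ (var x)))

⊢-cases : ∀ x θ → [] ⊢HA fsubF [ `0 / x ] θ → [] ⊢HA fsubF [ `S (var x) / x ] θ → [] ⊢HA θ
⊢-cases x θ zero-case suc-case = subst ([] ⊢HA_) (inst-absF-var x θ)
  (induction-at x (absF x θ) (absF-fresh x θ)
    (subst ([] ⊢HA_) (sym (inst-absF x θ `0)) zero-case)
    (hWk (subst ([] ⊢HA_) (sym (inst-absF x θ (`S (var x)))) suc-case)))

zero-or-suc : ∀ {Γ} k → Γ ⊢HA (var k ≐ `0) ∨' ∃' (var k ≐ `S (bvar zero))
zero-or-suc k = induction ((bvar zero ≐ `0) ∨' ∃' (bvar (suc zero) ≐ `S (bvar zero))) (var k)
  (h∨R₁ (h=R `0)) (∀-intro λ y → h→R (h∨R₂ (h∃R (var y) (h=R _))))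

<S-cases : ∀ {Γ} w k x → (var w `+ `S (var k) ≐ `S (var x)) ∷ Γ ⊢HA
           (var w ≐ var x) ∨' ∃' (var w `+ `S (bvar zero) ≐ var x)
<S-cases w k x = ∨-elim (zero-or-suc k)
  (h∨R₁ (≐-trans (≐-sym (hA+0 (var w))) (≐-subst (var w `+ bvar zero ≐ var x) hAx (hWk w+k≐x))))
  (∃-elim hAx λ k' → h∨R₂ (h∃R (var k') (≐-subst (var w `+ bvar zero ≐ var x) hAx (hWk (hWk w+k≐x)))))
  where
  w+k≐x : (var w `+ `S (var k) ≐ `S (var x)) ∷ _ ⊢HA var w `+ var k ≐ var x
  w+k≐x = S-injective (≐-trans (≐-sym (hA+S (var w) (var k))) hAx)

-- Below E t = ∀w. (∃k. w + S k = t) → E(w); UpTo E t is the same with w + k = t.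
Below : Formula 1 → Term 0 → Formula 0
Below E t = ∀' (∃' (bvar (suc zero) `+ `S (bvar zero) ≐ embT t) ⇒' E)

UpTo : Formula 1 → Term 0 → Formula 0
UpTo E t = ∀' (∃' (bvar (suc zero) `+ bvar zero ≐ embT t) ⇒' E)

Below-zero : ∀ {Γ} E → Γ ⊢HA Below E `0
Below-zero E = ∀-intro λ w → h→R (∃-elim hAx λ k →
  ex-falso (⇒-elim (hA0S (var w `+ var k)) (≐-trans (≐-sym hAx) (hA+S (var w) (var k)))))

Below-suc : ∀ {Γ} E x → Γ ⊢HA Below E (var x) → Γ ⊢HA inst E (var x) → Γ ⊢HA Below E (`S (var x))
Below-suc E x below Ex = ∀-intro λ w → h→R (∃-elim hAx λ k → ∨-elim (<S-cases w k x)
  (≐-subst E (≐-sym hAx) (hWk (hWk (hWk Ex))))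
  (⇒-elim (∀-elim (hWk (hWk (hWk below))) (var w)) hAx))

UpTo⇒Below : ∀ {Γ} E x → Γ ⊢HA UpTo E (var x) → Γ ⊢HA Below E (var x)
UpTo⇒Below E x upTo = ∀-intro λ w → h→R (∃-elim hAx λ k →
  ⇒-elim (∀-elim (hWk (hWk upTo)) (var w)) (h∃R (`S (var k)) hAx))

Below-suc⇒UpTo : ∀ {Γ} E x → Γ ⊢HA Below E (`S (var x)) → Γ ⊢HA UpTo E (var x)
Below-suc⇒UpTo E x below = ∀-intro λ w → h→R (∃-elim hAx λ k →
  ⇒-elim (∀-elim (hWk (hWk below)) (var w)) (h∃R (var k) (≐-trans (hA+S (var w) (var k)) (≐-cong-S hAx))))

UpTo-suc⇒UpTo : ∀ {Γ} E x → Γ ⊢HA UpTo E (`S (var x)) → Γ ⊢HA UpTo E (var x)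
UpTo-suc⇒UpTo E x upTo = ∀-intro λ w → h→R (∃-elim hAx λ k →
  ⇒-elim (∀-elim (hWk (hWk upTo)) (var w)) (h∃R (`S (var k)) (≐-trans (hA+S (var w) (var k)) (≐-cong-S hAx))))

UpTo⇒inst : ∀ {Γ} E x → Γ ⊢HA UpTo E (var x) → Γ ⊢HA inst E (var x)
UpTo⇒inst E x upTo = ⇒-elim (∀-elim upTo (var x)) (h∃R `0 (hA+0 (var x)))

-- Below E t with t abstracted, so that strong induction is induction on BelowF E.
BelowF : Formula 1 → Formula 1
BelowF E = ∀' (∃' (bvar (suc zero) `+ `S (bvar zero) ≐ bvar (suc (suc zero))) ⇒' bsubF (λ _ → bvar zero) E)

inst-BelowF : ∀ E t → inst (BelowF E) t ≡ Below E t
inst-BelowF E t = cong ∀' (cong₂ (λ u φ → ∃' (bvar (suc zero) `+ `S (bvar zero) ≐ u) ⇒' φ) weaken₂-t E-unchanged)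
  where
  weaken₂-t : renT suc (renT suc t) ≡ embT t
  weaken₂-t = trans (cong (renT suc ∘ renT suc) (sym (embT-id t)))
                    (trans (cong (renT suc) (renT-embT suc t)) (renT-embT suc t))
  E-unchanged : bsubF (liftσ (λ _ → t)) (bsubF (λ _ → bvar zero) E) ≡ E
  E-unchanged = trans (bsubF-bsubF _ _ E) (trans (bsubF-cong (λ { zero → refl }) E) (bsubF-bvar E))

strong-induction : ∀ E x → x ∉ fvF E → Below E (var x) ∷ [] ⊢HA inst E (var x) → [] ⊢HA inst E (var x)
strong-induction E x x∉E step = hCut below-x step
  where
  below-x : [] ⊢HA Below E (var x)
  below-x = subst ([] ⊢HA_) (inst-BelowF E (var x))
    (induction-at x (BelowF E) (x∉E ∘ subst (x ∈_) (fvF-bsubF (λ _ → refl) E))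
      (subst ([] ⊢HA_) (sym (inst-BelowF E `0)) (Below-zero E))
      (subst₂ (λ A B → A ∷ [] ⊢HA B) (sym (inst-BelowF E (var x))) (sym (inst-BelowF E (`S (var x))))
        (Below-suc E x hAx step)))

-- Companion hypotheses

data _⊑_ : Pol → Pol → Set where
  ⊑-refl     : ∀ {p} → p ⊑ p
  minus⊑plus : minus ⊑ plus

⊑-plus : ∀ p → p ⊑ plus
⊑-plus minus = minus⊑plus
⊑-plus plus  = ⊑-refl

⊑-trans : ∀ {p q r} → p ⊑ q → q ⊑ r → p ⊑ r
⊑-trans ⊑-refl     q⊑r = q⊑r
⊑-trans minus⊑plus ⊑-refl = minus⊑plus

Bounded : Pol → Formula 1 → Term 0 → Formula 0
Bounded minus = Below
Bounded plus  = UpTo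

Bounded-weaken : ∀ {Γ p' p} → p' ⊑ p → ∀ E x → Γ ⊢HA Bounded p E (var x) → Γ ⊢HA Bounded p' E (var x)
Bounded-weaken ⊑-refl     E x d = d
Bounded-weaken minus⊑plus E x d = UpTo⇒Below E x d

Bounded-suc⇒UpTo : ∀ {Γ} p E x → Γ ⊢HA Bounded p E (`S (var x)) → Γ ⊢HA UpTo E (var x)
Bounded-suc⇒UpTo minus = Below-suc⇒UpTo
Bounded-suc⇒UpTo plus  = UpTo-suc⇒UpTo

fvF-Bounded : ∀ p E x → fvF (Bounded p E (var x)) ≡ x ∷ fvF E
fvF-Bounded minus E x = refl
fvF-Bounded plus  E x = refl

fsubF-Bounded : ∀ (σ : FSub) p {E} → Closed E → ∀ x → fsubF σ (Bounded p E (var x)) ≡ Bounded p E (σ x)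
fsubF-Bounded σ minus {E} E-closed x = cong (λ φ → ∀' (∃' _ ⇒' φ)) (fsubF-id E (⊥-elim ∘ E-closed _))
fsubF-Bounded σ plus  {E} E-closed x = cong (λ φ → ∀' (∃' _ ⇒' φ)) (fsubF-id E (⊥-elim ∘ E-closed _))

hyp : Label → Formula 1 → Formula 0
hyp ℓ E = Bounded (lpol ℓ) E (var (lvar ℓ))

hyps : Stack → List (Formula 1) → Ctx
hyps = zipWith hyp

body : Label → Ctx → Formula 0
body ℓ A = (lctx ℓ ++ A) ⇛ lgoal ℓ

parameters : Label → Ctx → List ℕ
parameters ℓ A = filter (λ y → ¬? (y ≟ lvar ℓ)) (fvF (body ℓ A))

invariant : Label → Ctx → Formula 1
invariant ℓ A = absF (lvar ℓ) (closeAll (parameters ℓ A) (body ℓ A))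

invariant-closed : ∀ ℓ A → Closed (invariant ℓ A)
invariant-closed ℓ A y y∈E with ∈-fvF-absF⁻ (lvar ℓ) (closeAll (parameters ℓ A) (body ℓ A)) y∈E
... | y∈closure , y≢x with ∈-fvF-closeAll⁻ (parameters ℓ A) (body ℓ A) y∈closure
...   | y∈body , y∉parameters = y∉parameters (∈-filter⁺ (λ z → ¬? (z ≟ lvar ℓ)) y∈body y≢x)

invariant-intro : ∀ {Δ} ℓ A → (∀ {y} → y ∈ fvC Δ → y ≡ lvar ℓ) →
                  Δ ⊢HA body ℓ A → Δ ⊢HA inst (invariant ℓ A) (var (lvar ℓ))
invariant-intro {Δ} ℓ A fvΔ≡x d = subst (Δ ⊢HA_) (sym (inst-absF-var (lvar ℓ) (closeAll (parameters ℓ A) (body ℓ A))))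
  (closeAll-intro (parameters ℓ A) (body ℓ A) parameters∉Δ d)
  where
  parameters∉Δ : ∀ {y} → y ∈ parameters ℓ A → y ∉ fvC Δ
  parameters∉Δ y∈ps y∈Δ = proj₂ (∈-filter⁻ (λ z → ¬? (z ≟ lvar ℓ)) {xs = fvF (body ℓ A)} y∈ps) (fvΔ≡x y∈Δ)

invariant-elim : ∀ {Δ} ℓ A → Δ ⊢HA inst (invariant ℓ A) (var (lvar ℓ)) → Δ ⊢HA body ℓ A
invariant-elim {Δ} ℓ A d =
  closeAll-elim (parameters ℓ A) (body ℓ A) (subst (Δ ⊢HA_) (inst-absF-var (lvar ℓ) (closeAll (parameters ℓ A) (body ℓ A))) d)

Weaker : Label → Label → Set
Weaker ℓ' ℓ = lvar ℓ' ≡ lvar ℓ × lpol ℓ' ⊑ lpol ℓ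

_≼_ : Stack → Stack → Set
_≼_ = Pointwise Weaker

-- An invariant is built from the hypotheses below its label at the time it was pushed;
-- Case may since have turned some x^- into x^+, hence R' ≼ R.
data Invariants : Stack → List (Formula 1) → Set where
  []   : Invariants [] []
  push : ∀ {ℓ R Es} R' → R' ≼ R → Invariants R Es → Invariants (ℓ ∷ R) (invariant ℓ (hyps R' Es) ∷ Es)

Invariants-closed : ∀ {R Es} → Invariants R Es → All Closed Es
Invariants-closed []                           = []
Invariants-closed (push {ℓ} {Es = Es} R' _ I) = invariant-closed ℓ (hyps R' Es) ∷ Invariants-closed I

≼-refl : ∀ {R} → R ≼ R
≼-refl = Pointwise.refl (refl , ⊑-refl)

≼-trans : ∀ {R₁ R₂ R₃} → R₁ ≼ R₂ → R₂ ≼ R₃ → R₁ ≼ R₃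
≼-trans = Pointwise.transitive λ { (x₁≡x₂ , p₁⊑p₂) (x₂≡x₃ , p₂⊑p₃) → trans x₁≡x₂ x₂≡x₃ , ⊑-trans p₁⊑p₂ p₂⊑p₃ }

∈-fvC-hyps⁻ : ∀ R {Es} → All Closed Es → ∀ {y} → y ∈ fvC (hyps R Es) → y ∈ VarS R
∈-fvC-hyps⁻ (ℓ ∷ R) {E ∷ Es} (E-closed ∷ Es-closed) p with ∈-++⁻ (fvF (hyp ℓ E)) p
... | inj₂ q = there (∈-fvC-hyps⁻ R Es-closed q)
... | inj₁ q with subst (_ ∈_) (fvF-Bounded (lpol ℓ) E (lvar ℓ)) q
...   | here y≡x  = here y≡x
...   | there y∈E = ⊥-elim (E-closed _ y∈E)

fsubC-hyps : ∀ {σ : FSub} R {Es} → All Closed Es → (∀ {z} → z ∈ VarS R → σ z ≡ var z) → fsubC σ (hyps R Es) ≡ hyps R Es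
fsubC-hyps R {Es} Es-closed σ-fixes-R = fsubC-id (hyps R Es) (σ-fixes-R ∘ ∈-fvC-hyps⁻ R Es-closed)

hyps-weaker : ∀ {Γ R' R} → R' ≼ R → ∀ Es → All (Γ ⊢HA_) (hyps R Es) → All (Γ ⊢HA_) (hyps R' Es)
hyps-weaker []                      Es       _        = []
hyps-weaker (_ ∷ _)                 []       _        = []
hyps-weaker {Γ} {ℓ' ∷ _} ((x'≡x , p'⊑p) ∷ R'≼R) (E ∷ Es) (d ∷ ds) =
  subst (λ z → Γ ⊢HA Bounded (lpol ℓ') E (var z)) (sym x'≡x) (Bounded-weaken p'⊑p E _ d) ∷ hyps-weaker R'≼R Es ds

-- plusAt x Λ is definitionally map (plusAtLabel x) Λ.
plusAtLabel : ℕ → Label → Label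
plusAtLabel x ℓ = if does (lvar ℓ ≟ x) then record ℓ { lpol = plus } else ℓ

plusAtLabel-≡ : ∀ {x} ℓ → lvar ℓ ≡ x → plusAtLabel x ℓ ≡ record ℓ { lpol = plus }
plusAtLabel-≡ {x} ℓ x'≡x rewrite dec-true (lvar ℓ ≟ x) x'≡x = refl

plusAtLabel-≢ : ∀ {x} ℓ → lvar ℓ ≢ x → plusAtLabel x ℓ ≡ ℓ
plusAtLabel-≢ {x} ℓ x'≢x rewrite dec-false (lvar ℓ ≟ x) x'≢x = refl

≼-plusAt : ∀ x R → R ≼ plusAt x R
≼-plusAt x []      = []
≼-plusAt x (ℓ ∷ R) = weaker ∷ ≼-plusAt x R
  where
  weaker : Weaker ℓ (plusAtLabel x ℓ)
  weaker with lvar ℓ ≟ x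
  ... | yes x'≡x = subst (Weaker ℓ) (sym (plusAtLabel-≡ ℓ x'≡x)) (refl , ⊑-plus (lpol ℓ))
  ... | no  x'≢x = subst (Weaker ℓ) (sym (plusAtLabel-≢ ℓ x'≢x)) (refl , ⊑-refl)

invariant-plusAtLabel : ∀ x ℓ A → invariant (plusAtLabel x ℓ) A ≡ invariant ℓ A
invariant-plusAtLabel x ℓ A with lvar ℓ ≟ x
... | yes x'≡x = cong (λ ℓ' → invariant ℓ' A) (plusAtLabel-≡ ℓ x'≡x)
... | no  x'≢x = cong (λ ℓ' → invariant ℓ' A) (plusAtLabel-≢ ℓ x'≢x)

Invariants-plusAt : ∀ x {R Es} → Invariants R Es → Invariants (plusAt x R) Es
Invariants-plusAt x []                              = []
Invariants-plusAt x (push {ℓ} {R} {Es} R' R'≼R I) =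
  subst (λ E → Invariants (plusAt x (ℓ ∷ R)) (E ∷ Es)) (invariant-plusAtLabel x ℓ (hyps R' Es))
    (push R' (≼-trans R'≼R (≼-plusAt x R)) (Invariants-plusAt x I))

Invariants-drop : ∀ A {R Es} → Invariants (A ++ R) Es → ∃[ Es' ] Invariants R Es' × hyps R Es' ⊆ hyps (A ++ R) Es
Invariants-drop []      I            = _ , I , id
Invariants-drop (ℓ ∷ A) (push R' _ I) with Invariants-drop A I
... | Es' , I' , hyps⊆ = Es' , I' , there ∘ hyps⊆

hyp-case : ∀ {Γ} x ℓ {E} → Closed E → Γ ⊢HA fsubF [ `S (var x) / x ] (hyp ℓ E) → Γ ⊢HA hyp (plusAtLabel x ℓ) E
hyp-case {Γ} x ℓ {E} E-closed d with lvar ℓ ≟ x | subst (Γ ⊢HA_) (fsubF-Bounded _ (lpol ℓ) E-closed (lvar ℓ)) d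
... | yes refl | d' = subst (λ ℓ' → Γ ⊢HA hyp ℓ' E) (sym (plusAtLabel-≡ ℓ refl))
  (Bounded-suc⇒UpTo (lpol ℓ) E x (subst (λ u → Γ ⊢HA Bounded (lpol ℓ) E u) (update-≡ var x (`S (var x))) d'))
... | no x'≢x  | d' = subst (λ ℓ' → Γ ⊢HA hyp ℓ' E) (sym (plusAtLabel-≢ ℓ x'≢x))
  (subst (λ u → Γ ⊢HA Bounded (lpol ℓ) E u) (update-≢ var (`S (var x)) x'≢x) d')

hyps-case : ∀ {Γ} x R {Es} → All Closed Es →
            All (Γ ⊢HA_) (fsubC [ `S (var x) / x ] (hyps R Es)) → All (Γ ⊢HA_) (hyps (plusAt x R) Es)
hyps-case x []      _ _ = []
hyps-case x (ℓ ∷ R) {[]} _ _ = []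
hyps-case x (ℓ ∷ R) {E ∷ Es} (E-closed ∷ Es-closed) (d ∷ ds) = hyp-case x ℓ E-closed d ∷ hyps-case x R Es-closed ds

-- Translation of SHA derivations

reverse-︔ : ∀ Λ ℓ → reverse (Λ ︔ ℓ) ≡ ℓ ∷ reverse Λ
reverse-︔ Λ ℓ = reverse-++ Λ [ ℓ ]

∈-VarS-reverse⁻ : ∀ Λ {y} → y ∈ VarS (reverse Λ) → y ∈ VarS Λ
∈-VarS-reverse⁻ Λ = Any.reverse⁻ ∘ subst (_ ∈_) (reverse-map lvar Λ)

WF-∉ : ∀ {Λ v} Γ δ → WF Λ Γ δ → v ∉ fvSeq Γ δ → v ∉ VarS Λ
WF-∉ Γ δ (x∈ ∷ wf) v∉ (here refl) = v∉ x∈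
WF-∉ Γ δ (x∈ ∷ wf) v∉ (there v∈)  = WF-∉ Γ δ wf v∉ v∈

-- The stack R is listed from its top, i.e. it is the reverse of an SHA stack.
Sound : Stack → Ctx → Formula 0 → Set
Sound R Γ δ = ∀ {Es} → Invariants R Es → Γ ++ hyps R Es ⊢HA δ

∉-fvSeq-hyps : ∀ {y} Λ Γ φ {Es} → Invariants (reverse Λ) Es → y ∉ fvSeq Γ φ → y ∉ VarS Λ →
               y ∉ fvSeq (Γ ++ hyps (reverse Λ) Es) φ
∉-fvSeq-hyps Λ Γ φ {Es} I y∉Γφ y∉Λ y∈ with ∈-++⁻ (fvC (Γ ++ hyps (reverse Λ) Es)) y∈
... | inj₂ y∈φ     = y∉Γφ (∈-++⁺ʳ (fvC Γ) y∈φ)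
... | inj₁ y∈Γ++H with ∈-++⁻ (fvC Γ) (subst (_ ∈_) (concatMap-++ fvF Γ (hyps (reverse Λ) Es)) y∈Γ++H)
...   | inj₁ y∈Γ = y∉Γφ (∈-++⁺ˡ y∈Γ)
...   | inj₂ y∈H = y∉Λ (∈-VarS-reverse⁻ Λ (∈-fvC-hyps⁻ (reverse Λ) (Invariants-closed I) y∈H))

comp-rule : ∀ {R Γ δ} x (x∈ : x ∈ fvSeq Γ δ) → Sound (mkLabel x minus Γ δ x∈ ∷ R) Γ δ → Sound R Γ δ
comp-rule {R} {Γ} {δ} x x∈ sound {Es} I = ⇛-elim {[]} (Γ ++ H) (invariant-elim ℓ H (strong-induction E x x∉E step))
  where
  ℓ = mkLabel x minus Γ δ x∈
  H = hyps R Es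
  E = invariant ℓ H
  x∉E : x ∉ fvF E
  x∉E = invariant-closed ℓ H x
  step : Below E (var x) ∷ [] ⊢HA inst E (var x)
  step = invariant-intro ℓ H fv≡x (⇛-intro (Γ ++ H) (permute (shift _ Γ H) (sound (push R ≼-refl I))))
    where
    fv≡x : ∀ {y} → y ∈ fvC (Below E (var x) ∷ []) → y ≡ x
    fv≡x y∈ with ∈-++⁻ (fvF (Below E (var x))) y∈
    ... | inj₁ (here y≡x)  = y≡x
    ... | inj₁ (there y∈E) = ⊥-elim (invariant-closed ℓ H _ y∈E)

bud-rule : ∀ {R Γ δ} x (x∈ : x ∈ fvSeq Γ δ) → Sound (mkLabel x plus Γ δ x∈ ∷ R) Γ δ
bud-rule {R} {Γ} {δ} x x∈ (push {Es = Es} R' R'≼R I) =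
  ⇛-apply (Γ ++ A) (invariant-elim ℓ A (UpTo⇒inst E x (assumption (∈-++⁺ʳ Γ (here refl)))))
    (All.++⁺ (assumptions ∈-++⁺ˡ) (hyps-weaker R'≼R Es (assumptions (∈-++⁺ʳ Γ ∘ there))))
  where
  ℓ = mkLabel x plus Γ δ x∈
  A = hyps R' Es
  E = invariant ℓ A

pop-rule : ∀ A {R Γ δ} → Sound R Γ δ → Sound (A ++ R) Γ δ
pop-rule A {Γ = Γ} sound I with Invariants-drop A I
... | Es' , I' , hyps⊆ = weaken (++⁺ʳ Γ hyps⊆) (sound I')

case-rule : ∀ {R Γ δ} x → Sound R (fsubC [ `0 / x ] Γ) (fsubF [ `0 / x ] δ) →
            Sound (plusAt x R) (fsubC [ `S (var x) / x ] Γ) (fsubF [ `S (var x) / x ] δ) → Sound R Γ δ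
case-rule {R} {Γ} {δ} x sound₀ soundS {Es} I = ⇛-elim {[]} (Γ ++ H) (⊢-cases x ((Γ ++ H) ⇛ δ) zero-case suc-case)
  where
  H = hyps R Es
  close : ∀ σ → fsubC σ Γ ++ fsubC σ H ⊢HA fsubF σ δ → [] ⊢HA fsubF σ ((Γ ++ H) ⇛ δ)
  close σ d = subst ([] ⊢HA_) (sym (trans (fsubF-⇛ σ (Γ ++ H) δ) (cong (_⇛ fsubF σ δ) (map-++ (fsubF σ) Γ H))))
    (⇛-intro {[]} (fsubC σ Γ ++ fsubC σ H) d)
  zero-case : [] ⊢HA fsubF [ `0 / x ] ((Γ ++ H) ⇛ δ)
  zero-case = close [ `0 / x ]
    (subst₂ _⊢HA_ (trans (map-++ _ (fsubC [ `0 / x ] Γ) H) (cong (_++ fsubC [ `0 / x ] H) (fsubC-[0/x]-idem x Γ)))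
      (fsubF-[0/x]-idem x δ) (⊢-fsub x `0 (sound₀ I)))
  suc-case : [] ⊢HA fsubF [ `S (var x) / x ] ((Γ ++ H) ⇛ δ)
  suc-case = close [ `S (var x) / x ]
    (cut-all (weaken (++⁺ˡ (hyps (plusAt x R) Es) (xs⊆xs++ys (fsubC [ `S (var x) / x ] Γ) (fsubC [ `S (var x) / x ] H)))
                     (soundS (Invariants-plusAt x I)))
      (hyps-case x R (Invariants-closed I) (assumptions (∈-++⁺ʳ _))))

[s/x,t/y]-avoids : ∀ {v} x y s t → v ∉ fvT s → v ∉ fvT t → v ≡ x ⊎ v ≡ y → ∀ z → v ∉ fvT (update [ s / x ] y t z)
[s/x,t/y]-avoids x y s t v∉s v∉t v∈xy z = ∉-fvT-update [ s / x ] y t z v∉t λ z≢y →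
  ∉-fvT-update var x s z v∉s λ { z≢x (here refl) → [ z≢x , z≢y ]′ v∈xy }

≐L-conclusion-avoids : ∀ {v} x y s t Γ δ → v ∉ fvT s → v ∉ fvT t → v ≡ x ⊎ v ≡ y →
                       v ∉ fvSeq ((s ≐ t) ∷ fsubC (update [ s / x ] y t) Γ) (fsubF (update [ s / x ] y t) δ)
≐L-conclusion-avoids x y s t Γ δ v∉s v∉t v∈xy v∈ with ∈-++⁻ _ v∈
... | inj₂ v∈δ = ∉-fvF-fsubF ([s/x,t/y]-avoids x y s t v∉s v∉t v∈xy) δ v∈δ
... | inj₁ v∈ctx with ∈-++⁻ (fvT s ++ fvT t) v∈ctx
...   | inj₂ v∈Γ  = ∉-fvC-fsubC ([s/x,t/y]-avoids x y s t v∉s v∉t v∈xy) Γ v∈Γ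
...   | inj₁ v∈st = [ v∉s , v∉t ]′ (∈-++⁻ (fvT s) v∈st)

≐L-rule : ∀ Λ {Γ δ} x y s t → x ≢ y → x ∉ fvT s → x ∉ fvT t → y ∉ fvT s → y ∉ fvT t →
          WF Λ ((s ≐ t) ∷ fsubC (update [ s / x ] y t) Γ) (fsubF (update [ s / x ] y t) δ) →
          Sound (reverse Λ) (fsubC [ var x / y ] Γ) (fsubF [ var x / y ] δ) →
          Sound (reverse Λ) ((s ≐ t) ∷ fsubC (update [ s / x ] y t) Γ) (fsubF (update [ s / x ] y t) δ)
≐L-rule Λ {Γ} {δ} x y s t x≢y x∉s x∉t y∉s y∉t wf sound {Es} I =
  subst (λ Δ → (s ≐ t) ∷ Δ ⊢HA fsubF τ δ) (hyps-fixed τ τ-fixes)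
    (h=L x y s t x≢y x∉s x∉t y∉s y∉t
      (subst (_⊢HA fsubF [ var x / y ] δ) (sym (hyps-fixed [ var x / y ] σ-fixes)) (sound I)))
  where
  τ = update [ s / x ] y t
  H = hyps (reverse Λ) Es
  ∉Λ : ∀ {v} → v ∉ fvT s → v ∉ fvT t → v ≡ x ⊎ v ≡ y → v ∉ VarS (reverse Λ)
  ∉Λ v∉s v∉t v∈xy =
    WF-∉ ((s ≐ t) ∷ fsubC τ Γ) (fsubF τ δ) wf (≐L-conclusion-avoids x y s t Γ δ v∉s v∉t v∈xy) ∘ ∈-VarS-reverse⁻ Λ
  ≢Λ : ∀ {v z} → v ∉ VarS (reverse Λ) → z ∈ VarS (reverse Λ) → z ≢ v
  ≢Λ v∉Λ z∈Λ refl = v∉Λ z∈Λ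
  σ-fixes : ∀ {z} → z ∈ VarS (reverse Λ) → [ var x / y ] z ≡ var z
  σ-fixes z∈Λ = update-≢ var (var x) (≢Λ (∉Λ y∉s y∉t (inj₂ refl)) z∈Λ)
  τ-fixes : ∀ {z} → z ∈ VarS (reverse Λ) → τ z ≡ var z
  τ-fixes z∈Λ = trans (update-≢ [ s / x ] t (≢Λ (∉Λ y∉s y∉t (inj₂ refl)) z∈Λ))
                      (update-≢ var s (≢Λ (∉Λ x∉s x∉t (inj₁ refl)) z∈Λ))
  hyps-fixed : ∀ σ → (∀ {z} → z ∈ VarS (reverse Λ) → σ z ≡ var z) → fsubC σ (Γ ++ H) ≡ fsubC σ Γ ++ H
  hyps-fixed σ σ-fixes =
    trans (map-++ (fsubF σ) Γ H) (cong (fsubC σ Γ ++_) (fsubC-hyps (reverse Λ) (Invariants-closed I) σ-fixes))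

translate : ∀ {Λ Γ δ} → Λ ∣ Γ ⊢SHA δ → Sound (reverse Λ) Γ δ
translate {Λ} (sSet _ Γ⊆Γ' Γ'⊆Γ d) {Es} I =
  hSet (++⁺ˡ (hyps (reverse Λ) Es) Γ⊆Γ') (++⁺ˡ (hyps (reverse Λ) Es) Γ'⊆Γ) (translate d I)
translate (s→L _ d e)  I = h→L (translate d I) (translate e I)
translate (s→R _ d)    I = h→R (translate d I)
translate (s∧L _ d)    I = h∧L (translate d I)
translate (s∧R _ d e)  I = h∧R (translate d I) (translate e I)
translate (s∨L _ d e)  I = h∨L (translate d I) (translate e I)
translate (s∨R₁ _ d)   I = h∨R₁ (translate d I)
translate (s∨R₂ _ d)   I = h∨R₂ (translate d I)
translate (s∀L t _ d)  I = h∀L t (translate d I)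
translate {Λ} (s∀R {Γ = Γ} {φ} y y∉ y∉Λ _ d) I = h∀R y (∉-fvSeq-hyps Λ Γ (∀' φ) I y∉ y∉Λ) (translate d I)
translate {Λ} {δ = δ} (s∃L {Γ = Γ} {φ} y y∉ y∉Λ _ d) I = h∃L y (∉-fvSeq-hyps Λ (∃' φ ∷ Γ) δ I y∉ y∉Λ) (translate d I)
translate (s∃R t _ d)  I = h∃R t (translate d I)
translate (s⊥L _)      I = h⊥L
translate {Λ} (s=L x y s t x≢y x∉s x∉t y∉s y∉t wf d) = ≐L-rule Λ x y s t x≢y x∉s x∉t y∉s y∉t wf (translate d)
translate (s=R t _)    I = h=R t
translate (sWk _ d)    I = hWk (translate d I)
translate (sCut _ d e) I = hCut (translate d I) (translate e I)
translate sAx          I = hAx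
translate (sA0S t)     I = hA0S t
translate (sASS s t)   I = hASS s t
translate (sA+0 s)     I = hA+0 s
translate (sA+S s t)   I = hA+S s t
translate (sA·0 s)     I = hA·0 s
translate (sA·S s t)   I = hA·S s t
translate (sInd φ s)   I = hInd φ s
translate (sComp {Λ} x x∈ _ d) = comp-rule x x∈ (subst (λ R → Sound R _ _) (reverse-︔ Λ _) (translate d))
translate (sBud {Λ} x x∈ _)    = subst (λ R → Sound R _ _) (sym (reverse-︔ Λ _)) (bud-rule x x∈)
translate (sPop {Λ} {Λ'} d)    = subst (λ R → Sound R _ _) (sym (reverse-++ Λ Λ')) (pop-rule (reverse Λ') (translate d))
translate (sCase {Λ} x _ d₀ dS) =
  case-rule x (translate d₀) (subst (λ R → Sound R _ _) (sym (reverse-map (plusAtLabel x) Λ)) (translate dS))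

theorem4p3 : (Γ : Ctx) (δ : Formula 0) → SHA⊢ Γ δ → HA⊢ Γ δ
theorem4p3 Γ δ d = subst (_⊢HA δ) (++-identityʳ Γ) (translate d [])
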